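{- Let $0\le k\le n$ and $\sigma\in\mathcal{D}^S_k$. Then $$\sum_{\pi\in S_n,\ dp(\pi)=\sigma}(-1)^{\mathrm{inv}(\pi)}q^{\mathrm{maj}(\pi)}=(-1)^{\mathrm{inv}(\sigma)}q^{\mathrm{maj}(\sigma)}{n\brack k}_q.$$
   Context: $S_n$ is the symmetric group on $[n]$ and $\mathcal{D}^S_k$ the set of derangements (fixed-point-free permutations) of $[k]$ ($\mathcal{D}^S_0$ consists of the empty permutation). For $\sigma=\sigma_1\cdots\sigma_n$: $\mathrm{inv}(\sigma)=\#\{(i,j):i<j,\sigma_i>\sigma_j\}$, $\mathrm{maj}(\sigma)=\sum_{i:\sigma_i>\sigma_{i+1}}i$. The reduction of a word with distinct positive entries $a_1<\cdots<a_m$ is obtained by replacing each $a_j$ by $j$. The derangement part $dp(\pi)$ of $\pi\in S_n$ is the reduction of the subword of $\pi$ formed by the entries $\pi_i$ with $\pi_i\ne i$. $[n]_q=1+\cdots+q^{n-1}$, $[n]_q!=[1]_q\cdots[n]_q$, ${n\brack k}_q=\frac{[n]_q!}{[k]_q![n-k]_q!}$. -}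

module Defs where

open import Data.Nat using (ℕ; zero; suc; _+_; _≤_; _<_; _≟_; _≤?_; _<ᵇ_)
open import Data.Bool using (Bool; true; false; if_then_else_)
open import Data.List using (List; []; _∷_; length; map; concatMap; filter; upTo; sum; foldr)
open import Data.List.Relation.Unary.All using (All; all?)
open import Data.List.Relation.Unary.Unique.Propositional using (Unique)
open import Data.List.Relation.Unary.Unique.DecPropositional _≟_ using (unique?)
open import Data.Product using (_×_; _,_)
open import Relation.Nullary using (Dec; ¬_)
open import Relation.Nullary.Decidable using (_×-dec_; ¬?)
open import Relation.Binary.PropositionalEquality using (_≡_)
open import Data.Integer as ℤ using (ℤ)

-- Permutations in one-line notation: a word π = π₁⋯πₙ (List ℕ, entries 1-based).

IsPerm : ℕ → List ℕ → Set
IsPerm n w = (length w ≡ n) × Unique w × All (λ x → 1 ≤ x × x ≤ n) w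

isPerm? : (n : ℕ) → (w : List ℕ) → Dec (IsPerm n w)
isPerm? n w = (length w ≟ n) ×-dec (unique? w ×-dec all? (λ x → (1 ≤? x) ×-dec (x ≤? n)) w)

words : ℕ → ℕ → List (List ℕ)
words n zero = [] ∷ []
words n (suc m) = concatMap (λ a → map (a ∷_) (words n m)) (map suc (upTo n))

Sn : ℕ → List (List ℕ)
Sn n = filter (isPerm? n) (words n n)

NoFixFrom : ℕ → List ℕ → Set
NoFixFrom i [] = Data.Unit.⊤ where import Data.Unit
NoFixFrom i (x ∷ w) = (¬ x ≡ i) × NoFixFrom (suc i) w

IsDerangement : ℕ → List ℕ → Set
IsDerangement k σ = IsPerm k σ × NoFixFrom 1 σ

countLess : ℕ → List ℕ → ℕ
countLess x [] = 0
countLess x (y ∷ w) = (if y <ᵇ x then 1 else 0) + countLess x w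

inv : List ℕ → ℕ
inv [] = 0
inv (x ∷ w) = countLess x w + inv w

majFrom : ℕ → List ℕ → ℕ
majFrom i [] = 0
majFrom i (x ∷ []) = 0
majFrom i (x ∷ y ∷ w) = (if y <ᵇ x then i else 0) + majFrom (suc i) (y ∷ w)

maj : List ℕ → ℕ
maj = majFrom 1

nonFixedFrom : ℕ → List ℕ → List ℕ
nonFixedFrom i [] = []
nonFixedFrom i (x ∷ w) with x ≟ i
... | Relation.Nullary.yes _ = nonFixedFrom (suc i) w
... | Relation.Nullary.no _ = x ∷ nonFixedFrom (suc i) w

reduce : List ℕ → List ℕ
reduce w = map (λ a → suc (countLess a w)) w

dp : List ℕ → List ℕ
dp π = reduce (nonFixedFrom 1 π)

qint : ℤ → ℕ → ℤ
qint q zero = ℤ.0ℤ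
qint q (suc n) = ℤ.1ℤ ℤ.+ q ℤ.* qint q n

qfact : ℤ → ℕ → ℤ
qfact q zero = ℤ.1ℤ
qfact q (suc n) = qfact q n ℤ.* qint q (suc n)

sgn : ℕ → ℤ
sgn m = (ℤ.- ℤ.1ℤ) ℤ.^ m

wt : ℤ → List ℕ → ℤ
wt q π = sgn (inv π) ℤ.* (q ℤ.^ maj π)

sumℤ : List ℤ → ℤ
sumℤ = foldr ℤ._+_ ℤ.0ℤ

lhs : ℤ → ℕ → List ℕ → ℤ
lhs q n σ = sumℤ (map (wt q) (filter (λ π → Data.List.Properties.≡-dec _≟_ (dp π) σ) (Sn n)))
  where import Data.List.Properties

-- A permutation π with dp π = σ ∈ 𝒟_k is determined by its set of fixed points, encoded as a
-- word e with k letters true (moved entries) and n - k letters false (fixed points): with P the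
-- list of moved positions, π = inflate σ e carries P_{σ_j} at the j-th moved position.
-- Summing over e:
-- * the sign is constant, since the parity of the inversions between moved entries and fixed
--   points only depends on e and on the set P, so it is the same as for the identity;
-- * relabelling P_x ↦ 2x and a fixed point with c moved positions before it ↦ 2c+1 keeps all
--   descents, so maj π only depends on σ and e.  Because σ_j ≠ j, the letter 2σ_j lies on the
--   same side of the fixed-point labels 2j-1 and 2j+1 around it, and splitting the sum over e
--   by its last letter yields q^{maj σ} [n k]_q through the two q-Pascal recurrences.

module Submission where

open import Defs
open import Data.Bool using (Bool; true; false; not; if_then_else_; T) renaming (_≟_ to _≟ᵇ_)
open import Data.Integer as ℤ using (ℤ; _*_; _^_) renaming (_+_ to _+ᶻ_)
import Data.Integer.Properties as ℤ
import Data.Integer.Tactic.RingSolver as ℤ-Solver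
open import Data.List using (List; []; _∷_; [_]; _++_; _ʳ++_; length; map; filter; reverse)
open import Data.List.Membership.Propositional using (_∈_; _∉_)
open import Data.List.Membership.Propositional.Properties
  using (∈-map⁺; ∈-map⁻; ∈-++⁺ˡ; ∈-++⁺ʳ; ∈-∃++; ∈-filter⁺; ∈-filter⁻; ∈-concat⁺′; ∈-upTo⁺)
open import Data.List.Membership.Propositional.Properties.WithK using (unique∧set⇒bag)
open import Data.List.Properties
  using (map-∘; map-cong-local; map-id-local; map-++; length-++; length-map; length-reverse; ++-assoc;
         ∷-injectiveʳ; unfold-reverse; reverse-injective; reverse-involutive; reverse-map; ʳ++-defn; ≡-dec)
open import Data.List.Relation.Binary.BagAndSetEquality using (∼bag⇒↭)
open import Data.List.Relation.Binary.Permutation.Propositional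
  using (_↭_; ↭-refl; ↭-reflexive; ↭-sym; ↭-trans; ↭-prep; ↭⇒↭ₛ; module PermutationReasoning)
open import Data.List.Relation.Binary.Permutation.Propositional.Properties
  using (shift; ↭-length; All-resp-↭; ∈-resp-↭; drop-∷; ++⁺ʳ; ++-comm) renaming (map⁺ to ↭-map⁺)
import Data.List.Relation.Binary.Permutation.Setoid.Properties as PermSetoid
open import Data.List.Relation.Binary.Pointwise using (Pointwise; []; _∷_)
open import Data.List.Relation.Unary.All as All using (All; []; _∷_)
import Data.List.Relation.Unary.All.Properties as All
open import Data.List.Relation.Unary.AllPairs as AllPairs using (AllPairs; []; _∷_)
import Data.List.Relation.Unary.AllPairs.Properties as AllPairs
open import Data.List.Relation.Unary.Any using (here; there)
open import Data.List.Relation.Unary.Unique.Propositional using (Unique)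
import Data.List.Relation.Unary.Unique.Propositional.Properties as Unique
open import Data.Nat using (ℕ; zero; suc; _+_; _∸_; _≤_; _<_; _≟_; _<ᵇ_; z≤n; s≤s; z<s; _<?_)
import Data.Nat.ListAction as ℕ
import Data.Nat.ListAction.Properties as ℕ
open import Data.Nat.Properties
import Data.Nat.Tactic.RingSolver as ℕ-Solver
open import Data.Product using (_×_; _,_; proj₁; proj₂; map₁; map₂)
open import Data.Sum as Sum using (_⊎_; inj₁; inj₂)
open import Data.Unit using (⊤)
open import Function using (_∘_)
open import Function.Bundles using (mk⇔)
open import Relation.Binary.Definitions using (tri<; tri≈; tri>)
open import Relation.Binary.PropositionalEquality hiding ([_])
open import Relation.Nullary using (¬_; yes; no; contradiction)
open import Relation.Nullary.Decidable using (dec-true; dec-false)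

<ᵇ-true : ∀ {m n} → m < n → (m <ᵇ n) ≡ true
<ᵇ-true = dec-true (_ <? _)

<ᵇ-false : ∀ {m n} → ¬ m < n → (m <ᵇ n) ≡ false
<ᵇ-false = dec-false (_ <? _)

<ᵇ-flip : ∀ {m n} → m ≢ n → (n <ᵇ m) ≡ not (m <ᵇ n)
<ᵇ-flip {m} {n} m≢n with <-cmp m n
... | tri< m<n _ _ = trans (<ᵇ-false (<⇒≯ m<n)) (cong not (sym (<ᵇ-true m<n)))
... | tri≈ _ m≡n _ = contradiction m≡n m≢n
... | tri> _ _ n<m = trans (<ᵇ-true n<m) (cong not (sym (<ᵇ-false (<⇒≯ n<m))))

countLess-sum : ∀ x w → countLess x w ≡ ℕ.sum (map (λ y → if y <ᵇ x then 1 else 0) w)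
countLess-sum x [] = refl
countLess-sum x (y ∷ w) = cong ((if y <ᵇ x then 1 else 0) +_) (countLess-sum x w)

countLess-++ : ∀ x u w → countLess x (u ++ w) ≡ countLess x u + countLess x w
countLess-++ x u w = begin
  countLess x (u ++ w)                      ≡⟨ countLess-sum x (u ++ w) ⟩
  ℕ.sum (map _ (u ++ w))                    ≡⟨ cong ℕ.sum (map-++ _ u w) ⟩
  ℕ.sum (map _ u ++ map _ w)                ≡⟨ ℕ.sum-++ (map _ u) _ ⟩
  ℕ.sum (map _ u) + ℕ.sum (map _ w)         ≡⟨ sym (cong₂ _+_ (countLess-sum x u) (countLess-sum x w)) ⟩
  countLess x u + countLess x w             ∎
  where open ≡-Reasoning

countLess-↭ : ∀ x {u w} → u ↭ w → countLess x u ≡ countLess x w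
countLess-↭ x {u} {w} u↭w = begin
  countLess x u           ≡⟨ countLess-sum x u ⟩
  ℕ.sum (map _ u)         ≡⟨ ℕ.sum-↭ (↭-map⁺ _ u↭w) ⟩
  ℕ.sum (map _ w)         ≡⟨ sym (countLess-sum x w) ⟩
  countLess x w           ∎
  where open ≡-Reasoning

countLess-lowerBound : ∀ {x} w → All (x ≤_) w → countLess x w ≡ 0
countLess-lowerBound [] [] = refl
countLess-lowerBound (y ∷ w) (x≤y ∷ x≤w) rewrite <ᵇ-false (≤⇒≯ x≤y) = countLess-lowerBound w x≤w

countLess-upperBound : ∀ {x} w → All (_< x) w → countLess x w ≡ length w
countLess-upperBound [] [] = refl
countLess-upperBound (y ∷ w) (y<x ∷ w<x) rewrite <ᵇ-true y<x = cong suc (countLess-upperBound w w<x)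

countLess-mono : ∀ w {a b} → a ≤ b → countLess a w ≤ countLess b w
countLess-mono [] _ = z≤n
countLess-mono (y ∷ w) {a} {b} a≤b with y <? a
... | yes y<a rewrite <ᵇ-true y<a | <ᵇ-true (<-≤-trans y<a a≤b) = s≤s (countLess-mono w a≤b)
... | no y≮a rewrite <ᵇ-false y≮a = ≤-trans (countLess-mono w a≤b) (m≤n+m _ _)

countLess-map : ∀ (f : ℕ → ℕ) x w → (∀ {y} → y ∈ w → (f y <ᵇ f x) ≡ (y <ᵇ x)) →
                countLess (f x) (map f w) ≡ countLess x w
countLess-map f x [] _ = refl
countLess-map f x (y ∷ w) pres =
  cong₂ (λ b c → (if b then 1 else 0) + c) (pres (here refl)) (countLess-map f x w (pres ∘ there))

countGreater : ℕ → List ℕ → ℕ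
countGreater x [] = 0
countGreater x (y ∷ w) = (if x <ᵇ y then 1 else 0) + countGreater x w

countLess+countGreater : ∀ x w → x ∉ w → countLess x w + countGreater x w ≡ length w
countLess+countGreater x [] _ = refl
countLess+countGreater x (y ∷ w) x∉ = begin
  (if y <ᵇ x then 1 else 0) + countLess x w + ((if x <ᵇ y then 1 else 0) + countGreater x w)
    ≡⟨ cong (λ b → (if y <ᵇ x then 1 else 0) + countLess x w + ((if b then 1 else 0) + countGreater x w))
            (<ᵇ-flip (x∉ ∘ here ∘ sym)) ⟩
  (if y <ᵇ x then 1 else 0) + countLess x w + ((if not (y <ᵇ x) then 1 else 0) + countGreater x w)
    ≡⟨ exactly-one (y <ᵇ x) (countLess x w) (countGreater x w) ⟩
  suc (countLess x w + countGreater x w)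
    ≡⟨ cong suc (countLess+countGreater x w (x∉ ∘ there)) ⟩
  suc (length w) ∎
  where
  open ≡-Reasoning
  exactly-one : ∀ b l g → (if b then 1 else 0) + l + ((if not b then 1 else 0) + g) ≡ suc (l + g)
  exactly-one true l g = refl
  exactly-one false l g = +-suc l g

Unique-resp-↭ : ∀ {A : Set} {u w : List A} → u ↭ w → Unique u → Unique w
Unique-resp-↭ {A} u↭w = PermSetoid.Unique-resp-↭ (setoid A) (↭⇒↭ₛ u↭w)

↭-++-cancelˡ : ∀ {A : Set} (xs : List A) {ys zs} → xs ++ ys ↭ xs ++ zs → ys ↭ zs
↭-++-cancelˡ [] p = p
↭-++-cancelˡ (x ∷ xs) p = ↭-++-cancelˡ xs (drop-∷ p)

same-members⇒↭ : ∀ {A : Set} {xs ys : List A} → Unique xs → Unique ys →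
                 (∀ {x} → x ∈ xs → x ∈ ys) → (∀ {x} → x ∈ ys → x ∈ xs) → xs ↭ ys
same-members⇒↭ uxs uys xs⊆ys ys⊆xs = ∼bag⇒↭ (unique∧set⇒bag uxs uys (mk⇔ xs⊆ys ys⊆xs))

unique-⊆-↭ : ∀ {A : Set} {xs ys : List A} → Unique xs → Unique ys → All (_∈ ys) xs →
             length ys ≤ length xs → xs ↭ ys
unique-⊆-↭ {xs = []} {[]} _ _ _ _ = ↭-refl
unique-⊆-↭ {xs = x ∷ xs} (x∉xs ∷ uxs) uys (x∈ys ∷ xs⊆ys) |ys|≤ with ∈-∃++ x∈ys
... | as , bs , refl =
  ↭-trans (↭-prep x (unique-⊆-↭ uxs uas++bs xs⊆as++bs |as++bs|≤)) (↭-sym (shift x as bs))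
  where
  uas++bs : Unique (as ++ bs)
  uas++bs with Unique-resp-↭ (shift x as bs) uys
  ... | _ ∷ u = u
  xs⊆as++bs : All (_∈ as ++ bs) xs
  xs⊆as++bs = All.zipWith (λ (x≢y , y∈) → drop-x x≢y y∈) (x∉xs , xs⊆ys)
    where
    drop-x : ∀ {y} → x ≢ y → y ∈ as ++ [ x ] ++ bs → y ∈ as ++ bs
    drop-x x≢y y∈ with ∈-resp-↭ (shift x as bs) y∈
    ... | here y≡x = contradiction (sym y≡x) x≢y
    ... | there y∈′ = y∈′
  |as++bs|≤ : length (as ++ bs) ≤ length xs
  |as++bs|≤ = ≤-pred (subst (_≤ suc (length xs)) (↭-length (shift x as bs)) |ys|≤)

unique-++⇒disjoint : ∀ {A : Set} xs {ys : List A} → Unique (xs ++ ys) → ∀ {x} → x ∈ xs → x ∉ ys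
unique-++⇒disjoint (x ∷ xs) (x∉ ∷ _) (here refl) x∈ys = All.lookup x∉ (∈-++⁺ʳ xs x∈ys) refl
unique-++⇒disjoint (_ ∷ xs) (_ ∷ u) (there x∈) = unique-++⇒disjoint xs u x∈

Σ : {A : Set} → (A → ℤ) → List A → ℤ
Σ f xs = sumℤ (map f xs)

module _ {A : Set} where

  Σ-++ : ∀ (f : A → ℤ) xs ys → Σ f (xs ++ ys) ≡ Σ f xs +ᶻ Σ f ys
  Σ-++ f [] ys = sym (ℤ.+-identityˡ _)
  Σ-++ f (x ∷ xs) ys = trans (cong (f x +ᶻ_) (Σ-++ f xs ys)) (sym (ℤ.+-assoc (f x) _ _))

  Σ-map : ∀ {B : Set} (f : B → ℤ) (g : A → B) xs → Σ f (map g xs) ≡ Σ (f ∘ g) xs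
  Σ-map f g xs = cong sumℤ (sym (map-∘ xs))

  Σ-cong : ∀ {f g : A → ℤ} xs → (∀ {x} → x ∈ xs → f x ≡ g x) → Σ f xs ≡ Σ g xs
  Σ-cong xs f≡g = cong sumℤ (map-cong-local (All.tabulate f≡g))

  Σ-*ˡ : ∀ c (f : A → ℤ) xs → Σ (λ x → c * f x) xs ≡ c * Σ f xs
  Σ-*ˡ c f [] = sym (ℤ.*-zeroʳ c)
  Σ-*ˡ c f (x ∷ xs) = trans (cong (c * f x +ᶻ_) (Σ-*ˡ c f xs)) (sym (ℤ.*-distribˡ-+ c (f x) _))

  Σ-↭ : ∀ (f : A → ℤ) {xs ys} → xs ↭ ys → Σ f xs ≡ Σ f ys
  Σ-↭ f xs↭ys = PermSetoid.foldr-commMonoid (setoid ℤ) ℤ.+-0-isCommutativeMonoid (↭⇒↭ₛ (↭-map⁺ f xs↭ys))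

-- Interleavings

trues falses : List Bool → ℕ
trues [] = 0
trues (true ∷ e) = suc (trues e)
trues (false ∷ e) = trues e
falses [] = 0
falses (true ∷ e) = falses e
falses (false ∷ e) = suc (falses e)

length≡trues+falses : ∀ e → length e ≡ trues e + falses e
length≡trues+falses [] = refl
length≡trues+falses (true ∷ e) = cong suc (length≡trues+falses e)
length≡trues+falses (false ∷ e) = trans (cong suc (length≡trues+falses e)) (sym (+-suc (trues e) (falses e)))

trues-++ : ∀ e e′ → trues (e ++ e′) ≡ trues e + trues e′
trues-++ [] e′ = refl
trues-++ (true ∷ e) e′ = cong suc (trues-++ e e′)
trues-++ (false ∷ e) e′ = trues-++ e e′

falses-++ : ∀ e e′ → falses (e ++ e′) ≡ falses e + falses e′
falses-++ [] e′ = refl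
falses-++ (true ∷ e) e′ = falses-++ e e′
falses-++ (false ∷ e) e′ = cong suc (falses-++ e e′)

trues-reverse : ∀ e → trues (reverse e) ≡ trues e
trues-reverse [] = refl
trues-reverse (b ∷ e) = begin
  trues (reverse (b ∷ e))         ≡⟨ cong trues (unfold-reverse b e) ⟩
  trues (reverse e ++ [ b ])      ≡⟨ trues-++ (reverse e) [ b ] ⟩
  trues (reverse e) + trues [ b ] ≡⟨ cong (_+ trues [ b ]) (trues-reverse e) ⟩
  trues e + trues [ b ]           ≡⟨ +-comm (trues e) _ ⟩
  trues [ b ] + trues e           ≡⟨ trues-++ [ b ] e ⟨
  trues (b ∷ e)                   ∎
  where open ≡-Reasoning

falses-reverse : ∀ e → falses (reverse e) ≡ falses e
falses-reverse [] = refl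
falses-reverse (b ∷ e) = begin
  falses (reverse (b ∷ e))          ≡⟨ cong falses (unfold-reverse b e) ⟩
  falses (reverse e ++ [ b ])       ≡⟨ falses-++ (reverse e) [ b ] ⟩
  falses (reverse e) + falses [ b ] ≡⟨ cong (_+ falses [ b ]) (falses-reverse e) ⟩
  falses e + falses [ b ]           ≡⟨ +-comm (falses e) _ ⟩
  falses [ b ] + falses e           ≡⟨ falses-++ [ b ] e ⟨
  falses (b ∷ e)                    ∎
  where open ≡-Reasoning

module _ {A : Set} where

  interleave : List Bool → List A → List A → List A
  interleave [] xs ys = []
  interleave (true ∷ e) [] ys = []
  interleave (true ∷ e) (x ∷ xs) ys = x ∷ interleave e xs ys
  interleave (false ∷ e) xs [] = []
  interleave (false ∷ e) xs (y ∷ ys) = y ∷ interleave e xs ys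

  interleave-↭ : ∀ e xs ys → trues e ≡ length xs → falses e ≡ length ys →
                 interleave e xs ys ↭ xs ++ ys
  interleave-↭ [] [] [] _ _ = ↭-refl
  interleave-↭ (true ∷ e) (x ∷ xs) ys t f = ↭-prep x (interleave-↭ e xs ys (suc-injective t) f)
  interleave-↭ (false ∷ e) xs (y ∷ ys) t f =
    ↭-trans (↭-prep y (interleave-↭ e xs ys t (suc-injective f))) (↭-sym (shift y xs ys))

  ∈-interleave⁻ : ∀ {z} e xs ys → z ∈ interleave e xs ys → z ∈ xs ⊎ z ∈ ys
  ∈-interleave⁻ (true ∷ e) (x ∷ xs) ys (here z≡x) = inj₁ (here z≡x)
  ∈-interleave⁻ (true ∷ e) (x ∷ xs) ys (there z∈) = Sum.map₁ there (∈-interleave⁻ e xs ys z∈)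
  ∈-interleave⁻ (false ∷ e) xs (y ∷ ys) (here z≡y) = inj₂ (here z≡y)
  ∈-interleave⁻ (false ∷ e) xs (y ∷ ys) (there z∈) = Sum.map₂ there (∈-interleave⁻ e xs ys z∈)

  AllPairs-interleave : ∀ {R : A → A → Set} e xs ys →
    (∀ {x z} → x ∈ xs → R x z) → (∀ {x z} → x ∈ xs → R z x) → AllPairs R ys →
    AllPairs R (interleave e xs ys)
  AllPairs-interleave [] xs ys _ _ _ = []
  AllPairs-interleave (true ∷ e) [] ys _ _ _ = []
  AllPairs-interleave (true ∷ e) (x ∷ xs) ys before after Rys =
    All.tabulate (λ _ → before (here refl)) ∷
    AllPairs-interleave e xs ys (before ∘ there) (after ∘ there) Rys
  AllPairs-interleave (false ∷ e) xs [] _ _ _ = []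
  AllPairs-interleave {R} (false ∷ e) xs (y ∷ ys) before after (Ry ∷ Rys) =
    All.tabulate later ∷ AllPairs-interleave e xs ys before after Rys
    where
    later : ∀ {z} → z ∈ interleave e xs ys → R y z
    later z∈ with ∈-interleave⁻ e xs ys z∈
    ... | inj₁ z∈xs = after z∈xs
    ... | inj₂ z∈ys = All.lookup Ry z∈ys

interleave-map : ∀ {A B : Set} (f : A → B) e xs ys →
                 map f (interleave e xs ys) ≡ interleave e (map f xs) (map f ys)
interleave-map f [] xs ys = refl
interleave-map f (true ∷ e) [] ys = refl
interleave-map f (true ∷ e) (x ∷ xs) ys = cong (f x ∷_) (interleave-map f e xs ys)
interleave-map f (false ∷ e) xs [] = refl
interleave-map f (false ∷ e) xs (y ∷ ys) = cong (f y ∷_) (interleave-map f e xs ys)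

countLess-interleave : ∀ x e A B → trues e ≡ length A → falses e ≡ length B →
                       countLess x (interleave e A B) ≡ countLess x A + countLess x B
countLess-interleave x e A B t f = trans (countLess-↭ x (interleave-↭ e A B t f)) (countLess-++ x A B)

shuffles : ℕ → ℕ → List (List Bool)
shuffles zero zero = [ [] ]
shuffles zero (suc m) = map (false ∷_) (shuffles zero m)
shuffles (suc k) zero = map (true ∷_) (shuffles k zero)
shuffles (suc k) (suc m) = map (true ∷_) (shuffles k (suc m)) ++ map (false ∷_) (shuffles (suc k) m)

shuffles-counts : ∀ k m → All (λ e → trues e ≡ k × falses e ≡ m) (shuffles k m)
shuffles-counts zero zero = (refl , refl) ∷ []
shuffles-counts zero (suc m) = All.map⁺ (All.map (map₂ (cong suc)) (shuffles-counts zero m))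
shuffles-counts (suc k) zero = All.map⁺ (All.map (map₁ (cong suc)) (shuffles-counts k zero))
shuffles-counts (suc k) (suc m) =
  All.++⁺ (All.map⁺ (All.map (map₁ (cong suc)) (shuffles-counts k (suc m))))
          (All.map⁺ (All.map (map₂ (cong suc)) (shuffles-counts (suc k) m)))

∈-shuffles⁻ : ∀ k m {e} → e ∈ shuffles k m → trues e ≡ k × falses e ≡ m
∈-shuffles⁻ k m = All.lookup (shuffles-counts k m)

∈-shuffles⁺ : ∀ e {k m} → trues e ≡ k → falses e ≡ m → e ∈ shuffles k m
∈-shuffles⁺ [] refl refl = here refl
∈-shuffles⁺ (true ∷ e) {suc k} {zero} refl f = ∈-map⁺ (true ∷_) (∈-shuffles⁺ e refl f)
∈-shuffles⁺ (true ∷ e) {suc k} {suc m} refl f = ∈-++⁺ˡ (∈-map⁺ (true ∷_) (∈-shuffles⁺ e refl f))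
∈-shuffles⁺ (false ∷ e) {zero} {suc m} t refl = ∈-map⁺ (false ∷_) (∈-shuffles⁺ e t refl)
∈-shuffles⁺ (false ∷ e) {suc k} {suc m} t refl = ∈-++⁺ʳ _ (∈-map⁺ (false ∷_) (∈-shuffles⁺ e t refl))

shuffles-unique : ∀ k m → Unique (shuffles k m)
shuffles-unique zero zero = [] ∷ []
shuffles-unique zero (suc m) = Unique.map⁺ ∷-injectiveʳ (shuffles-unique zero m)
shuffles-unique (suc k) zero = Unique.map⁺ ∷-injectiveʳ (shuffles-unique k zero)
shuffles-unique (suc k) (suc m) =
  Unique.++⁺ (Unique.map⁺ ∷-injectiveʳ (shuffles-unique k (suc m)))
             (Unique.map⁺ ∷-injectiveʳ (shuffles-unique (suc k) m)) heads-differ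
  where
  heads-differ : ∀ {e} → ¬ (e ∈ map (true ∷_) (shuffles k (suc m)) × e ∈ map (false ∷_) (shuffles (suc k) m))
  heads-differ (e∈₁ , e∈₂) with ∈-map⁻ _ e∈₁ | ∈-map⁻ _ e∈₂
  ... | _ , _ , refl | _ , _ , ()

reverse-∈-shuffles : ∀ k m {e} → e ∈ shuffles k m → reverse e ∈ shuffles k m
reverse-∈-shuffles k m {e} e∈ with ∈-shuffles⁻ k m e∈
... | t , f = ∈-shuffles⁺ (reverse e) (trans (trues-reverse e) t) (trans (falses-reverse e) f)

shuffles-reverse : ∀ k m → map reverse (shuffles k m) ↭ shuffles k m
shuffles-reverse k m =
  same-members⇒↭ (Unique.map⁺ reverse-injective (shuffles-unique k m)) (shuffles-unique k m) to from
  where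
  to : ∀ {e} → e ∈ map reverse (shuffles k m) → e ∈ shuffles k m
  to e∈ with ∈-map⁻ reverse e∈
  ... | _ , e′∈ , refl = reverse-∈-shuffles k m e′∈
  from : ∀ {e} → e ∈ shuffles k m → e ∈ map reverse (shuffles k m)
  from {e} e∈ = subst (_∈ _) (reverse-involutive e) (∈-map⁺ reverse (reverse-∈-shuffles k m e∈))

-- Permutations of [n]

Increasing : List ℕ → Set
Increasing = AllPairs _<_

range : ℕ → ℕ → List ℕ
range i zero = []
range i (suc n) = i ∷ range (suc i) n

length-range : ∀ i n → length (range i n) ≡ n
length-range i zero = refl
length-range i (suc n) = cong suc (length-range (suc i) n)

∈-range⁻ : ∀ {a} i n → a ∈ range i n → i ≤ a × a < i + n
∈-range⁻ i (suc n) (here refl) = ≤-refl , m<m+n i z<s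
∈-range⁻ {a} i (suc n) (there a∈) with ∈-range⁻ (suc i) n a∈
... | i<a , a<i+n = <⇒≤ i<a , subst (a <_) (sym (+-suc i n)) a<i+n

∈-range⁺ : ∀ {a} i n → i ≤ a → a < i + n → a ∈ range i n
∈-range⁺ i zero i≤a a<i+0 = contradiction (subst (_ <_) (+-identityʳ i) a<i+0) (≤⇒≯ i≤a)
∈-range⁺ {a} i (suc n) i≤a a<i+n with i ≟ a
... | yes refl = here refl
... | no i≢a = there (∈-range⁺ (suc i) n (≤∧≢⇒< i≤a i≢a) (subst (a <_) (+-suc i n) a<i+n))

range-increasing : ∀ i n → Increasing (range i n)
range-increasing i zero = []
range-increasing i (suc n) =
  All.tabulate (λ a∈ → proj₁ (∈-range⁻ (suc i) n a∈)) ∷ range-increasing (suc i) n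

increasing⇒unique : ∀ {w} → Increasing w → Unique w
increasing⇒unique = AllPairs.map <⇒≢

range-unique : ∀ i n → Unique (range i n)
range-unique i n = increasing⇒unique (range-increasing i n)

isPerm⇒↭range : ∀ {n w} → IsPerm n w → w ↭ range 1 n
isPerm⇒↭range {n} (len , uw , bounds) =
  unique-⊆-↭ uw (range-unique 1 n)
    (All.map (λ (1≤x , x≤n) → ∈-range⁺ 1 n 1≤x (s≤s x≤n)) bounds)
    (≤-reflexive (trans (length-range 1 n) (sym len)))

↭range⇒isPerm : ∀ {n w} → w ↭ range 1 n → IsPerm n w
↭range⇒isPerm {n} w↭ =
  trans (↭-length w↭) (length-range 1 n) ,
  Unique-resp-↭ (↭-sym w↭) (range-unique 1 n) ,
  All-resp-↭ (↭-sym w↭) (All.tabulate (λ x∈ → map₂ ≤-pred (∈-range⁻ 1 n x∈)))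

countLess-range : ∀ i n d → d ≤ n → countLess (d + i) (range i n) ≡ d
countLess-range i zero zero _ = refl
countLess-range i (suc n) zero _ rewrite <ᵇ-false (n≮n i) =
  countLess-lowerBound (range (suc i) n) (All.tabulate (λ a∈ → <⇒≤ (proj₁ (∈-range⁻ (suc i) n a∈))))
countLess-range i (suc n) (suc d) (s≤s d≤n) rewrite <ᵇ-true (s≤s (m≤n+m i d)) =
  cong suc (trans (cong (λ x → countLess x (range (suc i) n)) (sym (+-suc d i))) (countLess-range (suc i) n d d≤n))

reduce-map : ∀ (f : ℕ → ℕ) w → (∀ {x y} → x ∈ w → y ∈ w → (f y <ᵇ f x) ≡ (y <ᵇ x)) →
             reduce (map f w) ≡ reduce w
reduce-map f w pres = begin
  map (λ a → suc (countLess a (map f w))) (map f w)   ≡⟨ map-∘ w ⟨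
  map (λ x → suc (countLess (f x) (map f w))) w
    ≡⟨ map-cong-local (All.tabulate λ x∈ → cong suc (countLess-map f _ w (pres x∈))) ⟩
  map (λ x → suc (countLess x w)) w                   ∎
  where open ≡-Reasoning

reduce-perm : ∀ {k σ} → IsPerm k σ → reduce σ ≡ σ
reduce-perm {k} {σ} σ-perm@(_ , _ , bounds) = map-id-local (All.map rank bounds)
  where
  rank : ∀ {x} → 1 ≤ x × x ≤ k → suc (countLess x σ) ≡ x
  rank {suc d} (_ , d<k) = cong suc (begin
    countLess (suc d) σ           ≡⟨ countLess-↭ (suc d) (isPerm⇒↭range σ-perm) ⟩
    countLess (suc d) (range 1 k) ≡⟨ cong (λ x → countLess x (range 1 k)) (+-comm 1 d) ⟩
    countLess (d + 1) (range 1 k) ≡⟨ countLess-range 1 k d (<⇒≤ d<k) ⟩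
    d                             ∎)
    where open ≡-Reasoning

words-complete : ∀ n m w → length w ≡ m → All (λ x → 1 ≤ x × x ≤ n) w → w ∈ words n m
words-complete n zero [] _ _ = here refl
words-complete n (suc m) (suc a ∷ w) len ((_ , a<n) ∷ bounds) =
  ∈-concat⁺′ (∈-map⁺ (suc a ∷_) (words-complete n m w (suc-injective len) bounds))
             (∈-map⁺ (λ b → map (b ∷_) (words n m)) (∈-map⁺ suc (∈-upTo⁺ a<n)))

words-unique : ∀ n m → Unique (words n m)
words-unique n zero = [] ∷ []
words-unique n (suc m) =
  Unique.concat⁺ (All.map⁺ (All.tabulate (λ _ → Unique.map⁺ ∷-injectiveʳ (words-unique n m))))
                 (AllPairs.map⁺ (AllPairs.map heads-differ (Unique.map⁺ suc-injective (Unique.upTo⁺ n))))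
  where
  heads-differ : ∀ {a b} → a ≢ b → ∀ {w} → ¬ (w ∈ map (a ∷_) (words n m) × w ∈ map (b ∷_) (words n m))
  heads-differ a≢b (w∈₁ , w∈₂) with ∈-map⁻ _ w∈₁ | ∈-map⁻ _ w∈₂
  ... | _ , _ , refl | _ , _ , refl = a≢b refl

∈-Sn⁺ : ∀ {n π} → IsPerm n π → π ∈ Sn n
∈-Sn⁺ {n} {π} π-perm@(len , _ , bounds) = ∈-filter⁺ (isPerm? n) (words-complete n n π len bounds) π-perm

∈-Sn⁻ : ∀ {n π} → π ∈ Sn n → IsPerm n π
∈-Sn⁻ {n} π∈ = proj₂ (∈-filter⁻ (isPerm? n) {xs = words n n} π∈)

Sn-unique : ∀ n → Unique (Sn n)
Sn-unique n = Unique.filter⁺ (isPerm? n) (words-unique n n)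

-- Relabelling by an increasing list

-- 1-based, with junk value 0 outside 1 … length P
nth : List ℕ → ℕ → ℕ
nth (p ∷ P) (suc zero) = p
nth (p ∷ P) (suc (suc i)) = nth P (suc i)
nth _ _ = 0

InRange : List ℕ → ℕ → Set
InRange P x = 1 ≤ x × x ≤ length P

nth-∈ : ∀ P {x} → InRange P x → nth P x ∈ P
nth-∈ (p ∷ P) {suc zero} _ = here refl
nth-∈ (p ∷ P) {suc (suc x)} (_ , s≤s x<) = there (nth-∈ P (s≤s z≤n , x<))

module _ {p P} (p<P : All (p <_) P) where

  countLess-head : countLess p (p ∷ P) ≡ 0
  countLess-head rewrite <ᵇ-false (n≮n p) = countLess-lowerBound P (All.map <⇒≤ p<P)

  countLess-tail : ∀ {a} → a ∈ P → countLess a (p ∷ P) ≡ suc (countLess a P)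
  countLess-tail a∈ rewrite <ᵇ-true (All.lookup p<P a∈) = refl

countLess-nth : ∀ {P} → Increasing P → ∀ {x} → InRange P x → suc (countLess (nth P x) P) ≡ x
countLess-nth (p<P ∷ _) {suc zero} _ = cong suc (countLess-head p<P)
countLess-nth {p ∷ P} (p<P ∷ P↑) {suc (suc x)} (_ , s≤s x<) =
  trans (cong suc (countLess-tail p<P (nth-∈ P (s≤s z≤n , x<)))) (cong suc (countLess-nth P↑ (s≤s z≤n , x<)))

nth-countLess : ∀ {P} → Increasing P → ∀ {a} → a ∈ P → nth P (suc (countLess a P)) ≡ a
nth-countLess (p<P ∷ _) (here refl) rewrite countLess-head p<P = refl
nth-countLess (p<P ∷ P↑) (there a∈) rewrite countLess-tail p<P a∈ = nth-countLess P↑ a∈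

nth-injective : ∀ {P} → Increasing P → ∀ {x y} → InRange P x → InRange P y → nth P x ≡ nth P y → x ≡ y
nth-injective {P} P↑ x∈ y∈ eq =
  trans (sym (countLess-nth P↑ x∈)) (trans (cong (λ a → suc (countLess a P)) eq) (countLess-nth P↑ y∈))

nth-<ᵇ : ∀ {P} → Increasing P → ∀ {x y} → InRange P x → InRange P y → (nth P x <ᵇ nth P y) ≡ (x <ᵇ y)
nth-<ᵇ {p ∷ P} (p<P ∷ P↑) {suc zero} {suc zero} _ _ = <ᵇ-false (n≮n p)
nth-<ᵇ {p ∷ P} (p<P ∷ P↑) {suc zero} {suc (suc y)} _ (_ , s≤s y<) =
  <ᵇ-true (All.lookup p<P (nth-∈ P (s≤s z≤n , y<)))
nth-<ᵇ {p ∷ P} (p<P ∷ P↑) {suc (suc x)} {suc zero} (_ , s≤s x<) _ =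
  <ᵇ-false (<⇒≯ (All.lookup p<P (nth-∈ P (s≤s z≤n , x<))))
nth-<ᵇ {p ∷ P} (p<P ∷ P↑) {suc (suc x)} {suc (suc y)} (_ , s≤s x<) (_ , s≤s y<) =
  nth-<ᵇ P↑ (s≤s z≤n , x<) (s≤s z≤n , y<)

map-nth-range : ∀ P → map (nth P) (range 1 (length P)) ≡ P
map-nth-range [] = refl
map-nth-range (p ∷ P) = cong (p ∷_) (trans (shift-index 0 (length P)) (map-nth-range P))
  where
  shift-index : ∀ i n → map (nth (p ∷ P)) (range (suc (suc i)) n) ≡ map (nth P) (range (suc i) n)
  shift-index i zero = refl
  shift-index i (suc n) = cong (nth P (suc i) ∷_) (shift-index (suc i) n)

nth-reduce : ∀ {P W} → Increasing P → W ↭ P → map (nth P) (reduce W) ≡ W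
nth-reduce {P} {W} P↑ W↭P = trans (sym (map-∘ W)) (map-id-local (All.tabulate relabel))
  where
  relabel : ∀ {a} → a ∈ W → nth P (suc (countLess a W)) ≡ a
  relabel {a} a∈ rewrite countLess-↭ a W↭P = nth-countLess P↑ (∈-resp-↭ W↭P a∈)

countLess-suc-∈ : ∀ {P} → Increasing P → ∀ {a} → a ∈ P → countLess (suc a) P ≡ suc (countLess a P)
countLess-suc-∈ {p ∷ P} (p<P ∷ _) (here refl) rewrite <ᵇ-true (n<1+n p) | countLess-head p<P =
  cong suc (countLess-lowerBound P p<P)
countLess-suc-∈ {p ∷ P} (p<P ∷ P↑) (there a∈) rewrite countLess-tail p<P a∈ | <ᵇ-true (m<n⇒m<1+n (All.lookup p<P a∈)) =
  cong suc (countLess-suc-∈ P↑ a∈)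

-- Fixed points

positions : Bool → ℕ → List Bool → List ℕ
positions b i [] = []
positions b i (c ∷ e) with c ≟ᵇ b
... | yes _ = i ∷ positions b (suc i) e
... | no _ = positions b (suc i) e

positions-lowerBound : ∀ b i e → All (i ≤_) (positions b i e)
positions-lowerBound b i [] = []
positions-lowerBound b i (c ∷ e) with c ≟ᵇ b
... | yes _ = ≤-refl ∷ All.map (≤-trans (n≤1+n i)) (positions-lowerBound b (suc i) e)
... | no _ = All.map (≤-trans (n≤1+n i)) (positions-lowerBound b (suc i) e)

positions-increasing : ∀ b i e → Increasing (positions b i e)
positions-increasing b i [] = []
positions-increasing b i (c ∷ e) with c ≟ᵇ b
... | yes _ = positions-lowerBound b (suc i) e ∷ positions-increasing b (suc i) e
... | no _ = positions-increasing b (suc i) e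

length-positions-true : ∀ i e → length (positions true i e) ≡ trues e
length-positions-true i [] = refl
length-positions-true i (true ∷ e) = cong suc (length-positions-true (suc i) e)
length-positions-true i (false ∷ e) = length-positions-true (suc i) e

length-positions-false : ∀ i e → length (positions false i e) ≡ falses e
length-positions-false i [] = refl
length-positions-false i (true ∷ e) = length-positions-false (suc i) e
length-positions-false i (false ∷ e) = cong suc (length-positions-false (suc i) e)

interleave-positions : ∀ i e → interleave e (positions true i e) (positions false i e) ≡ range i (length e)
interleave-positions i [] = refl
interleave-positions i (true ∷ e) = cong (i ∷_) (interleave-positions (suc i) e)
interleave-positions i (false ∷ e) = cong (i ∷_) (interleave-positions (suc i) e)

moves : ℕ → List ℕ → List Bool
moves i [] = []
moves i (x ∷ w) with x ≟ i
... | yes _ = false ∷ moves (suc i) w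
... | no _ = true ∷ moves (suc i) w

length-moves : ∀ i w → length (moves i w) ≡ length w
length-moves i [] = refl
length-moves i (x ∷ w) with x ≟ i
... | yes _ = cong suc (length-moves (suc i) w)
... | no _ = cong suc (length-moves (suc i) w)

trues-moves : ∀ i w → trues (moves i w) ≡ length (nonFixedFrom i w)
trues-moves i [] = refl
trues-moves i (x ∷ w) with x ≟ i
... | yes _ = trues-moves (suc i) w
... | no _ = cong suc (trues-moves (suc i) w)

interleave-moves : ∀ i w → interleave (moves i w) (nonFixedFrom i w) (positions false i (moves i w)) ≡ w
interleave-moves i [] = refl
interleave-moves i (x ∷ w) with x ≟ i
... | yes refl = cong (x ∷_) (interleave-moves (suc i) w)
... | no _ = cong (x ∷_) (interleave-moves (suc i) w)

nonFixedFrom-interleave : ∀ i e A → Pointwise _≢_ A (positions true i e) →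
                          nonFixedFrom i (interleave e A (positions false i e)) ≡ A
nonFixedFrom-interleave i [] [] [] = refl
nonFixedFrom-interleave i (true ∷ e) (a ∷ A) (a≢i ∷ A≢) with a ≟ i
... | yes a≡i = contradiction a≡i a≢i
... | no _ = cong (a ∷_) (nonFixedFrom-interleave (suc i) e A A≢)
nonFixedFrom-interleave i (false ∷ e) A A≢ with i ≟ i
... | yes _ = nonFixedFrom-interleave (suc i) e A A≢
... | no i≢i = contradiction refl i≢i

moves-interleave : ∀ i e A → Pointwise _≢_ A (positions true i e) →
                   moves i (interleave e A (positions false i e)) ≡ e
moves-interleave i [] [] [] = refl
moves-interleave i (true ∷ e) (a ∷ A) (a≢i ∷ A≢) with a ≟ i
... | yes a≡i = contradiction a≡i a≢i
... | no _ = cong (true ∷_) (moves-interleave (suc i) e A A≢)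
moves-interleave i (false ∷ e) A A≢ with i ≟ i
... | yes _ = cong (false ∷_) (moves-interleave (suc i) e A A≢)
... | no i≢i = contradiction refl i≢i

noFix⇒pointwise : ∀ {i} w → NoFixFrom i w → Pointwise _≢_ w (range i (length w))
noFix⇒pointwise [] _ = []
noFix⇒pointwise (x ∷ w) (x≢i , w-noFix) = x≢i ∷ noFix⇒pointwise w w-noFix

map-≢ : ∀ {S : ℕ → Set} (f : ℕ → ℕ) → (∀ {x y} → S x → S y → f x ≡ f y → x ≡ y) →
        ∀ {xs ys} → All S xs → All S ys → Pointwise _≢_ xs ys → Pointwise _≢_ (map f xs) (map f ys)
map-≢ f f-inj [] [] [] = []
map-≢ f f-inj (Sx ∷ Sxs) (Sy ∷ Sys) (x≢y ∷ xs≢ys) = (x≢y ∘ f-inj Sx Sy) ∷ map-≢ f f-inj Sxs Sys xs≢ys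

-- Inversions of an interleaving

double : ℕ → ℕ
double x = x + x

crossings : List Bool → ℕ
crossings [] = 0
crossings (true ∷ e) = falses e + crossings e
crossings (false ∷ e) = crossings e

ascents : List ℕ → List ℕ → ℕ
ascents A [] = 0
ascents A (b ∷ B) = countLess b A + ascents A B

ascents-∷ : ∀ a A B → ascents (a ∷ A) B ≡ countGreater a B + ascents A B
ascents-∷ a A [] = refl
ascents-∷ a A (b ∷ B) = begin
  ((if a <ᵇ b then 1 else 0) + countLess b A) + ascents (a ∷ A) B
    ≡⟨ cong (((if a <ᵇ b then 1 else 0) + countLess b A) +_) (ascents-∷ a A B) ⟩
  ((if a <ᵇ b then 1 else 0) + countLess b A) + (countGreater a B + ascents A B)
    ≡⟨ +-interchange (if a <ᵇ b then 1 else 0) (countLess b A) (countGreater a B) (ascents A B) ⟩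
  ((if a <ᵇ b then 1 else 0) + countGreater a B) + (countLess b A + ascents A B) ∎
  where
  open ≡-Reasoning
  +-interchange : ∀ p q r s → (p + q) + (r + s) ≡ (p + r) + (q + s)
  +-interchange = ℕ-Solver.solve-∀

ascents-↭ : ∀ {A A′} B → A ↭ A′ → ascents A B ≡ ascents A′ B
ascents-↭ [] _ = refl
ascents-↭ (b ∷ B) A↭A′ = cong₂ _+_ (countLess-↭ b A↭A′) (ascents-↭ B A↭A′)

risingPairs : List Bool → List ℕ → List ℕ → ℕ
risingPairs (true ∷ e) (a ∷ A) B = countGreater a B + risingPairs e A B
risingPairs (false ∷ e) A (b ∷ B) = risingPairs e A B
risingPairs _ _ _ = 0

-- A pair (a, b) ∈ A × B is an inversion iff exactly one of "a comes first" and "a < b" holds,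
-- so cross inversions + 2 · #{a first, a < b} = #{a first} + #{a < b}.
inv-interleave : ∀ e A B → trues e ≡ length A → falses e ≡ length B → (∀ {a} → a ∈ A → a ∉ B) →
  inv (interleave e A B) + double (risingPairs e A B) ≡ inv A + inv B + crossings e + ascents A B
inv-interleave [] [] [] _ _ _ = refl
inv-interleave (true ∷ e) (a ∷ A) B t f A∩B=∅ = begin
  countLess a (interleave e A B) + inv (interleave e A B) + double (countGreater a B + risingPairs e A B)
    ≡⟨ cong (λ c → c + inv (interleave e A B) + double (countGreater a B + risingPairs e A B))
            (countLess-interleave a e A B (suc-injective t) f) ⟩
  countLess a A + countLess a B + inv (interleave e A B) + double (countGreater a B + risingPairs e A B)
    ≡⟨ regroup (countLess a A) (countLess a B) (inv (interleave e A B)) (countGreater a B) (risingPairs e A B) ⟩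
  countLess a A + (countLess a B + countGreater a B) + countGreater a B + (inv (interleave e A B) + double (risingPairs e A B))
    ≡⟨ cong₂ (λ l r → countLess a A + l + countGreater a B + r)
             (trans (countLess+countGreater a B (A∩B=∅ (here refl))) (sym f))
             (inv-interleave e A B (suc-injective t) f (A∩B=∅ ∘ there)) ⟩
  countLess a A + falses e + countGreater a B + (inv A + inv B + crossings e + ascents A B)
    ≡⟨ regroup′ (countLess a A) (falses e) (countGreater a B) (inv A) (inv B) (crossings e) (ascents A B) ⟩
  countLess a A + inv A + inv B + (falses e + crossings e) + (countGreater a B + ascents A B)
    ≡⟨ cong (countLess a A + inv A + inv B + (falses e + crossings e) +_) (ascents-∷ a A B) ⟨
  inv (a ∷ A) + inv B + crossings (true ∷ e) + ascents (a ∷ A) B ∎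
  where
  open ≡-Reasoning
  regroup : ∀ p q r s w → p + q + r + ((s + w) + (s + w)) ≡ p + (q + s) + s + (r + (w + w))
  regroup = ℕ-Solver.solve-∀
  regroup′ : ∀ p f s i j c d → p + f + s + (i + j + c + d) ≡ p + i + j + (f + c) + (s + d)
  regroup′ = ℕ-Solver.solve-∀
inv-interleave (false ∷ e) A (b ∷ B) t f A∩B=∅ = begin
  countLess b (interleave e A B) + inv (interleave e A B) + double (risingPairs e A B)
    ≡⟨ cong (λ c → c + inv (interleave e A B) + double (risingPairs e A B))
            (countLess-interleave b e A B t (suc-injective f)) ⟩
  countLess b A + countLess b B + inv (interleave e A B) + double (risingPairs e A B)
    ≡⟨ +-assoc (countLess b A + countLess b B) _ _ ⟩
  countLess b A + countLess b B + (inv (interleave e A B) + double (risingPairs e A B))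
    ≡⟨ cong (countLess b A + countLess b B +_) (inv-interleave e A B t (suc-injective f) λ a∈ → A∩B=∅ a∈ ∘ there) ⟩
  countLess b A + countLess b B + (inv A + inv B + crossings e + ascents A B)
    ≡⟨ regroup (countLess b A) (countLess b B) (inv A) (inv B) (crossings e) (ascents A B) ⟩
  inv A + (countLess b B + inv B) + crossings e + (countLess b A + ascents A B) ∎
  where
  open ≡-Reasoning
  regroup : ∀ p q i j c d → p + q + (i + j + c + d) ≡ i + (q + j) + c + (p + d)
  regroup = ℕ-Solver.solve-∀

inv-increasing : ∀ {w} → Increasing w → inv w ≡ 0
inv-increasing [] = refl
inv-increasing {x ∷ w} (x<w ∷ w↑) = cong₂ _+_ (countLess-lowerBound w (All.map <⇒≤ x<w)) (inv-increasing w↑)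

inv-map : ∀ (f : ℕ → ℕ) w → (∀ {x y} → x ∈ w → y ∈ w → (f y <ᵇ f x) ≡ (y <ᵇ x)) → inv (map f w) ≡ inv w
inv-map f [] _ = refl
inv-map f (x ∷ w) pres =
  cong₂ _+_ (countLess-map f x w (pres (here refl) ∘ there)) (inv-map f w (λ x∈ y∈ → pres (there x∈) (there y∈)))

sgn-+-double : ∀ m w → sgn (m + double w) ≡ sgn m
sgn-+-double m w = begin
  sgn (m + double w)       ≡⟨ ℤ.^-distribˡ-+-* _ m (double w) ⟩
  sgn m * sgn (double w)   ≡⟨ cong (sgn m *_) (sgn-double w) ⟩
  sgn m * ℤ.1ℤ             ≡⟨ ℤ.*-identityʳ (sgn m) ⟩
  sgn m                    ∎
  where
  open ≡-Reasoning
  sgn-double : ∀ w → sgn (double w) ≡ ℤ.1ℤ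
  sgn-double zero = refl
  sgn-double (suc w) rewrite +-suc w w = cong (λ s → ℤ.-1ℤ * (ℤ.-1ℤ * s)) (sgn-double w)

-- Major index

majFrom-++-pair : ∀ i w b a → majFrom i (w ++ b ∷ a ∷ []) ≡ majFrom i (w ++ [ b ]) + (if a <ᵇ b then i + length w else 0)
majFrom-++-pair i [] b a =
  trans (+-identityʳ _) (cong (λ n → if a <ᵇ b then n else 0) (sym (+-identityʳ i)))
majFrom-++-pair i (x ∷ []) b a =
  cong₂ _+_ (sym (+-identityʳ _))
            (trans (majFrom-++-pair (suc i) [] b a) (cong (λ n → if a <ᵇ b then n else 0) (trans (+-identityʳ (suc i)) (+-comm 1 i))))
majFrom-++-pair i (x ∷ y ∷ w) b a = begin
  (if y <ᵇ x then i else 0) + majFrom (suc i) (y ∷ w ++ b ∷ a ∷ [])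
    ≡⟨ cong ((if y <ᵇ x then i else 0) +_) (majFrom-++-pair (suc i) (y ∷ w) b a) ⟩
  (if y <ᵇ x then i else 0) + (majFrom (suc i) (y ∷ w ++ [ b ]) + (if a <ᵇ b then suc i + length (y ∷ w) else 0))
    ≡⟨ +-assoc (if y <ᵇ x then i else 0) _ _ ⟨
  (if y <ᵇ x then i else 0) + majFrom (suc i) (y ∷ w ++ [ b ]) + (if a <ᵇ b then suc i + length (y ∷ w) else 0)
    ≡⟨ cong (λ n → (if y <ᵇ x then i else 0) + majFrom (suc i) (y ∷ w ++ [ b ]) + (if a <ᵇ b then n else 0))
            (sym (+-suc i (length (y ∷ w)))) ⟩
  majFrom i (x ∷ y ∷ w ++ [ b ]) + (if a <ᵇ b then i + length (x ∷ y ∷ w) else 0) ∎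
  where open ≡-Reasoning

revMaj : List ℕ → ℕ
revMaj [] = 0
revMaj (a ∷ []) = 0
revMaj (a ∷ b ∷ w) = (if a <ᵇ b then suc (length w) else 0) + revMaj (b ∷ w)

maj-reverse : ∀ w → maj (reverse w) ≡ revMaj w
maj-reverse [] = refl
maj-reverse (a ∷ []) = refl
maj-reverse (a ∷ b ∷ w) = begin
  majFrom 1 (w ʳ++ (b ∷ a ∷ []))
    ≡⟨ cong (majFrom 1) (ʳ++-defn w) ⟩
  majFrom 1 (reverse w ++ b ∷ a ∷ [])
    ≡⟨ majFrom-++-pair 1 (reverse w) b a ⟩
  majFrom 1 (reverse w ++ [ b ]) + (if a <ᵇ b then suc (length (reverse w)) else 0)
    ≡⟨ cong₂ (λ r n → majFrom 1 r + (if a <ᵇ b then suc n else 0)) (ʳ++-defn w) (sym (length-reverse w)) ⟨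
  majFrom 1 (w ʳ++ [ b ]) + (if a <ᵇ b then suc (length w) else 0)
    ≡⟨ cong (_+ (if a <ᵇ b then suc (length w) else 0)) (maj-reverse (b ∷ w)) ⟩
  revMaj (b ∷ w) + (if a <ᵇ b then suc (length w) else 0)
    ≡⟨ +-comm (revMaj (b ∷ w)) _ ⟩
  revMaj (a ∷ b ∷ w) ∎
  where open ≡-Reasoning

maj≡revMaj∘reverse : ∀ w → maj w ≡ revMaj (reverse w)
maj≡revMaj∘reverse w = trans (cong maj (sym (reverse-involutive w))) (maj-reverse (reverse w))

majFrom-map : ∀ (f : ℕ → ℕ) i w → AllPairs (λ a b → (b <ᵇ a) ≡ (f b <ᵇ f a)) w → majFrom i (map f w) ≡ majFrom i w
majFrom-map f i [] _ = refl
majFrom-map f i (x ∷ []) _ = refl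
majFrom-map f i (x ∷ y ∷ w) ((xy ∷ _) ∷ rest) =
  cong₂ (λ b m → (if b then i else 0) + m) (sym xy) (majFrom-map f (suc i) (y ∷ w) rest)

double-<ᵇ : ∀ a b → (double a <ᵇ double b) ≡ (a <ᵇ b)
double-<ᵇ zero zero = refl
double-<ᵇ zero (suc b) = refl
double-<ᵇ (suc a) zero = refl
double-<ᵇ (suc a) (suc b) rewrite +-suc a a | +-suc b b = double-<ᵇ a b

maj-double-reverse : ∀ σ → maj σ ≡ revMaj (map double (reverse σ))
maj-double-reverse σ = begin
  maj σ                             ≡⟨ majFrom-map double 1 σ (all-pairs σ) ⟨
  maj (map double σ)                ≡⟨ maj≡revMaj∘reverse (map double σ) ⟩
  revMaj (reverse (map double σ))   ≡⟨ cong revMaj (reverse-map double σ) ⟨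
  revMaj (map double (reverse σ))   ∎
  where
  open ≡-Reasoning
  all-pairs : ∀ w → AllPairs (λ a b → (b <ᵇ a) ≡ (double b <ᵇ double a)) w
  all-pairs [] = []
  all-pairs (x ∷ w) = All.tabulate (λ {y} _ → sym (double-<ᵇ y x)) ∷ all-pairs w

-- The x-th element of P goes to 2x; a value outside P with c elements of P below it goes to 2c+1.
squeeze : List ℕ → ℕ → ℕ
squeeze P v = suc (countLess v P + countLess (suc v) P)

key : ℕ → ℕ
key c = suc (double c)

module _ {P} (P↑ : Increasing P) where

  squeeze-nth : ∀ {x} → InRange P x → squeeze P (nth P x) ≡ double x
  squeeze-nth x∈ = trans (cong (λ t → suc (countLess (nth P _) P + t)) (countLess-suc-∈ P↑ (nth-∈ P x∈)))
                         (cong double (countLess-nth P↑ x∈))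

  squeeze-mono : ∀ {a b} → a ≤ b → squeeze P a ≤ squeeze P b
  squeeze-mono a≤b = s≤s (+-mono-≤ (countLess-mono P a≤b) (countLess-mono P (s≤s a≤b)))

  squeeze-strict : ∀ {a b} → b < a → a ∈ P ⊎ b ∈ P → squeeze P b < squeeze P a
  squeeze-strict {a} {b} b<a (inj₁ a∈P) = s≤s (+-mono-≤-< (countLess-mono P (<⇒≤ b<a))
    (≤-<-trans (countLess-mono P b<a) (subst (countLess a P <_) (sym (countLess-suc-∈ P↑ a∈P)) (n<1+n _))))
  squeeze-strict {a} {b} b<a (inj₂ b∈P) = s≤s (+-mono-<-≤
    (<-≤-trans (subst (countLess b P <_) (sym (countLess-suc-∈ P↑ b∈P)) (n<1+n _)) (countLess-mono P b<a))
    (countLess-mono P (s≤s (<⇒≤ b<a))))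

  squeeze-<ᵇ : ∀ {a b} → a ≢ b → a ∈ P ⊎ b ∈ P ⊎ a < b → (b <ᵇ a) ≡ (squeeze P b <ᵇ squeeze P a)
  squeeze-<ᵇ {a} {b} a≢b a∈P⊎b∈P⊎a<b with <-cmp b a
  ... | tri≈ _ b≡a _ = contradiction (sym b≡a) a≢b
  ... | tri> _ _ a<b = trans (<ᵇ-false (<⇒≯ a<b)) (sym (<ᵇ-false (≤⇒≯ (squeeze-mono (<⇒≤ a<b)))))
  ... | tri< b<a _ _ with a∈P⊎b∈P⊎a<b
  ...   | inj₁ a∈P = trans (<ᵇ-true b<a) (sym (<ᵇ-true (squeeze-strict b<a (inj₁ a∈P))))
  ...   | inj₂ (inj₁ b∈P) = trans (<ᵇ-true b<a) (sym (<ᵇ-true (squeeze-strict b<a (inj₂ b∈P))))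
  ...   | inj₂ (inj₂ a<b) = contradiction a<b (<⇒≯ b<a)

fill : (ℕ → ℕ) → List Bool → List ℕ → List ℕ
fill β [] u = []
fill β (true ∷ r) [] = []
fill β (true ∷ r) (x ∷ u) = x ∷ fill β r u
fill β (false ∷ r) u = β (length u) ∷ fill β r u

spread : (ℕ → ℕ) → ℕ → List Bool → List ℕ → List ℕ
spread β c [] v = []
spread β c (true ∷ e) [] = []
spread β c (true ∷ e) (x ∷ v) = x ∷ spread β (suc c) e v
spread β c (false ∷ e) v = β c ∷ spread β c e v

spread-ʳ++ : ∀ β e v r u → trues e ≡ length v →
             spread β (length u) e v ʳ++ fill β r u ≡ fill β (e ʳ++ r) (v ʳ++ u)
spread-ʳ++ β [] [] r u _ = refl
spread-ʳ++ β (true ∷ e) (x ∷ v) r u t = spread-ʳ++ β e v (true ∷ r) (x ∷ u) (suc-injective t)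
spread-ʳ++ β (false ∷ e) v r u t = spread-ʳ++ β e v (false ∷ r) u t

reverse-spread : ∀ β e v → trues e ≡ length v → reverse (spread β 0 e v) ≡ fill β (reverse e) (reverse v)
reverse-spread β e v = spread-ʳ++ β e v [] []

interleave-squeeze : ∀ P Pre i e v → All (_< i) Pre → P ≡ Pre ++ positions true i e →
                     interleave e v (map (squeeze P) (positions false i e)) ≡ spread key (length Pre) e v
interleave-squeeze P Pre i [] v _ _ = refl
interleave-squeeze P Pre i (true ∷ e) [] _ _ = refl
interleave-squeeze P Pre i (true ∷ e) (x ∷ v) Pre<i P≡ = cong (x ∷_) (begin
  interleave e v (map (squeeze P) (positions false (suc i) e))
    ≡⟨ interleave-squeeze P (Pre ++ [ i ]) (suc i) e v
         (All.++⁺ (All.map m<n⇒m<1+n Pre<i) (≤-refl ∷ [])) (trans P≡ (sym (++-assoc Pre [ i ] _))) ⟩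
  spread key (length (Pre ++ [ i ])) e v
    ≡⟨ cong (λ c → spread key c e v) (trans (length-++ Pre) (+-comm (length Pre) 1)) ⟩
  spread key (suc (length Pre)) e v ∎)
  where open ≡-Reasoning
interleave-squeeze P Pre i (false ∷ e) v Pre<i P≡ =
  cong₂ _∷_ (cong₂ (λ l l′ → suc (l + l′)) (countLess-at i Pre<i (n≤1+n i))
                                             (countLess-at (suc i) (All.map m<n⇒m<1+n Pre<i) ≤-refl))
            (interleave-squeeze P Pre (suc i) e v (All.map m<n⇒m<1+n Pre<i) P≡)
  where
  countLess-at : ∀ j → All (_< j) Pre → j ≤ suc i → countLess j P ≡ length Pre
  countLess-at j Pre<j j≤1+i = begin
    countLess j P                                                  ≡⟨ cong (countLess j) P≡ ⟩
    countLess j (Pre ++ positions true (suc i) e)                  ≡⟨ countLess-++ j Pre _ ⟩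
    countLess j Pre + countLess j (positions true (suc i) e)       ≡⟨ cong₂ _+_ (countLess-upperBound Pre Pre<j)
      (countLess-lowerBound _ (All.map (≤-trans j≤1+i) (positions-lowerBound true (suc i) e))) ⟩
    length Pre + 0                                                 ≡⟨ +-identityʳ _ ⟩
    length Pre                                                     ∎
    where open ≡-Reasoning

-- The fibre of dp over a derangement

inflate : List ℕ → List Bool → List ℕ
inflate σ e = interleave e (map (nth (positions true 1 e)) σ) (positions false 1 e)

module Inflation {k σ e} (σ-perm : IsPerm k σ) (e-trues : trues e ≡ k) where

  P B A : List ℕ
  P = positions true 1 e
  B = positions false 1 e
  A = map (nth P) σ

  P↑ : Increasing P
  P↑ = positions-increasing true 1 e

  |P|≡k : length P ≡ k
  |P|≡k = trans (length-positions-true 1 e) e-trues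

  trues≡|A| : trues e ≡ length A
  trues≡|A| = trans e-trues (sym (trans (length-map (nth P) σ) (proj₁ σ-perm)))

  trues≡|P| : trues e ≡ length P
  trues≡|P| = sym (length-positions-true 1 e)

  falses≡|B| : falses e ≡ length B
  falses≡|B| = sym (length-positions-false 1 e)

  σ-inRange : ∀ {x} → x ∈ σ → InRange P x
  σ-inRange x∈ = subst (λ n → 1 ≤ _ × _ ≤ n) (sym |P|≡k) (All.lookup (proj₂ (proj₂ σ-perm)) x∈)

  nth-<ᵇ-σ : ∀ {x y} → x ∈ σ → y ∈ σ → (nth P y <ᵇ nth P x) ≡ (y <ᵇ x)
  nth-<ᵇ-σ x∈ y∈ = nth-<ᵇ P↑ (σ-inRange y∈) (σ-inRange x∈)

  relabel-range : map (nth P) (range 1 k) ≡ P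
  relabel-range = trans (cong (map (nth P) ∘ range 1) (sym |P|≡k)) (map-nth-range P)

  A↭P : A ↭ P
  A↭P = ↭-trans (↭-map⁺ (nth P) (isPerm⇒↭range σ-perm)) (↭-reflexive relabel-range)

  inflate-↭ : inflate σ e ↭ range 1 (length e)
  inflate-↭ = begin
    interleave e A B    ↭⟨ interleave-↭ e A B trues≡|A| falses≡|B| ⟩
    A ++ B              ↭⟨ ++⁺ʳ B A↭P ⟩
    P ++ B              ↭⟨ interleave-↭ e P B trues≡|P| falses≡|B| ⟨
    interleave e P B    ≡⟨ interleave-positions 1 e ⟩
    range 1 (length e)  ∎
    where open PermutationReasoning

  module _ (σ-noFix : NoFixFrom 1 σ) where

    A≢P : Pointwise _≢_ A P
    A≢P = subst (Pointwise _≢_ A) (trans (cong (map (nth P) ∘ range 1) (proj₁ σ-perm)) relabel-range)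
            (map-≢ (nth P) (nth-injective P↑) (All.tabulate σ-inRange) (All.tabulate range-inRange)
                   (noFix⇒pointwise σ σ-noFix))
      where
      range-inRange : ∀ {x} → x ∈ range 1 (length σ) → InRange P x
      range-inRange x∈ with ∈-range⁻ 1 (length σ) x∈
      ... | 1≤x , x<1+|σ| = 1≤x , subst (_ ≤_) (trans (proj₁ σ-perm) (sym |P|≡k)) (≤-pred x<1+|σ|)

    dp-inflate : dp (inflate σ e) ≡ σ
    dp-inflate = begin
      reduce (nonFixedFrom 1 (interleave e A B)) ≡⟨ cong reduce (nonFixedFrom-interleave 1 e A A≢P) ⟩
      reduce (map (nth P) σ)                     ≡⟨ reduce-map (nth P) σ nth-<ᵇ-σ ⟩
      reduce σ                                   ≡⟨ reduce-perm σ-perm ⟩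
      σ                                          ∎
      where open ≡-Reasoning

    moves-inflate : moves 1 (inflate σ e) ≡ e
    moves-inflate = moves-interleave 1 e A A≢P

  sgn-inflate : sgn (inv (inflate σ e)) ≡ sgn (inv σ)
  sgn-inflate = begin
    sgn (inv (inflate σ e))                               ≡⟨ sgn-+-double (inv (inflate σ e)) (risingPairs e A B) ⟨
    sgn (inv (inflate σ e) + double (risingPairs e A B))  ≡⟨ cong sgn inflate-vs-identity ⟩
    sgn (inv σ + double (risingPairs e P B))              ≡⟨ sgn-+-double (inv σ) (risingPairs e P B) ⟩
    sgn (inv σ)                                           ∎
    where
    open ≡-Reasoning
    P∩B=∅ : ∀ {a} → a ∈ P → a ∉ B
    P∩B=∅ = unique-++⇒disjoint P (Unique-resp-↭ (interleave-↭ e P B trues≡|P| falses≡|B|)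
              (subst Unique (sym (interleave-positions 1 e)) (range-unique 1 (length e))))
    identity-inv : inv (interleave e P B) ≡ 0
    identity-inv = trans (cong inv (interleave-positions 1 e)) (inv-increasing (range-increasing 1 (length e)))
    A-inv : inv A ≡ inv σ
    A-inv = inv-map (nth P) σ nth-<ᵇ-σ
    inflate-vs-identity : inv (inflate σ e) + double (risingPairs e A B) ≡ inv σ + double (risingPairs e P B)
    inflate-vs-identity = begin
      inv (interleave e A B) + double (risingPairs e A B)
        ≡⟨ inv-interleave e A B trues≡|A| falses≡|B| (P∩B=∅ ∘ ∈-resp-↭ A↭P) ⟩
      inv A + inv B + crossings e + ascents A B
        ≡⟨ cong₂ (λ i a → i + inv B + crossings e + a) A-inv (ascents-↭ B A↭P) ⟩
      inv σ + inv B + crossings e + ascents P B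
        ≡⟨ regroup (inv σ) (inv B) (crossings e) (ascents P B) ⟩
      inv σ + (0 + inv B + crossings e + ascents P B)
        ≡⟨ cong (λ i → inv σ + (i + inv B + crossings e + ascents P B)) (inv-increasing P↑) ⟨
      inv σ + (inv P + inv B + crossings e + ascents P B)
        ≡⟨ cong (inv σ +_) (inv-interleave e P B trues≡|P| falses≡|B| P∩B=∅) ⟨
      inv σ + (inv (interleave e P B) + double (risingPairs e P B))
        ≡⟨ cong (λ i → inv σ + (i + double (risingPairs e P B))) identity-inv ⟩
      inv σ + double (risingPairs e P B) ∎
      where
      regroup : ∀ s b c a → s + b + c + a ≡ s + (0 + b + c + a)
      regroup = ℕ-Solver.solve-∀

  maj-inflate : maj (inflate σ e) ≡ revMaj (fill key (reverse e) (map double (reverse σ)))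
  maj-inflate = begin
    maj (interleave e A B)                                       ≡⟨ majFrom-map (squeeze P) 1 _ order ⟨
    maj (map (squeeze P) (interleave e A B))                     ≡⟨ cong maj (interleave-map (squeeze P) e A B) ⟩
    maj (interleave e (map (squeeze P) A) (map (squeeze P) B))   ≡⟨ cong (λ v → maj (interleave e v B′)) squeeze-A ⟩
    maj (interleave e (map double σ) (map (squeeze P) B))        ≡⟨ cong maj (interleave-squeeze P [] 1 e (map double σ) [] refl) ⟩
    maj (spread key 0 e (map double σ))                          ≡⟨ maj≡revMaj∘reverse (spread key 0 e (map double σ)) ⟩
    revMaj (reverse (spread key 0 e (map double σ)))             ≡⟨ cong revMaj (reverse-spread key e (map double σ) |dσ|) ⟩
    revMaj (fill key (reverse e) (reverse (map double σ)))       ≡⟨ cong (revMaj ∘ fill key (reverse e)) (reverse-map double σ) ⟨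
    revMaj (fill key (reverse e) (map double (reverse σ)))       ∎
    where
    open ≡-Reasoning
    B′ = map (squeeze P) B
    |dσ| : trues e ≡ length (map double σ)
    |dσ| = trans e-trues (sym (trans (length-map double σ) (proj₁ σ-perm)))
    squeeze-A : map (squeeze P) A ≡ map double σ
    squeeze-A = trans (sym (map-∘ σ)) (map-cong-local (All.tabulate (squeeze-nth P↑ ∘ σ-inRange)))
    order : AllPairs (λ a b → (b <ᵇ a) ≡ (squeeze P b <ᵇ squeeze P a)) (interleave e A B)
    order = AllPairs.map (λ (a≢b , s) → squeeze-<ᵇ P↑ a≢b s) (AllPairs.zip (distinct , placed))
      where
      distinct : Unique (interleave e A B)
      distinct = proj₁ (proj₂ (↭range⇒isPerm inflate-↭))
      placed : AllPairs (λ a b → a ∈ P ⊎ b ∈ P ⊎ a < b) (interleave e A B)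
      placed = AllPairs-interleave e A B (inj₁ ∘ ∈-resp-↭ A↭P) (inj₂ ∘ inj₁ ∘ ∈-resp-↭ A↭P)
                 (AllPairs.map (inj₂ ∘ inj₂) (positions-increasing false 1 e))

inflate-dp-moves : ∀ {n π} → IsPerm n π → inflate (dp π) (moves 1 π) ≡ π
inflate-dp-moves {n} {π} π-perm =
  trans (cong (λ A → interleave e A B) (nth-reduce (positions-increasing true 1 e) W↭P)) (interleave-moves 1 π)
  where
  e = moves 1 π
  W = nonFixedFrom 1 π
  P = positions true 1 e
  B = positions false 1 e
  W++B↭P++B : W ++ B ↭ P ++ B
  W++B↭P++B = begin
    W ++ B             ↭⟨ interleave-↭ e W B (trues-moves 1 π) (sym (length-positions-false 1 e)) ⟨
    interleave e W B   ≡⟨ interleave-moves 1 π ⟩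
    π                  ↭⟨ isPerm⇒↭range π-perm ⟩
    range 1 n          ≡⟨ cong (range 1) (trans (length-moves 1 π) (proj₁ π-perm)) ⟨
    range 1 (length e) ≡⟨ interleave-positions 1 e ⟨
    interleave e P B   ↭⟨ interleave-↭ e P B (sym (length-positions-true 1 e)) (sym (length-positions-false 1 e)) ⟩
    P ++ B             ∎
    where open PermutationReasoning
  W↭P : W ↭ P
  W↭P = ↭-++-cancelˡ B (↭-trans (++-comm B W) (↭-trans W++B↭P++B (++-comm P B)))

fiber : ℕ → List ℕ → List (List ℕ)
fiber n σ = filter (λ π → ≡-dec _≟_ (dp π) σ) (Sn n)

inflate-∈-fiber : ∀ {n k σ e} → k ≤ n → IsDerangement k σ → e ∈ shuffles k (n ∸ k) → inflate σ e ∈ fiber n σ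
inflate-∈-fiber {n} {k} {σ} {e} k≤n (σ-perm , σ-noFix) e∈ with ∈-shuffles⁻ k (n ∸ k) e∈
... | t , f = ∈-filter⁺ _ (∈-Sn⁺ (↭range⇒isPerm (subst (λ l → inflate σ e ↭ range 1 l) |e|≡n inflate-↭)))
                          (dp-inflate σ-noFix)
  where
  open Inflation {e = e} σ-perm t
  |e|≡n : length e ≡ n
  |e|≡n = trans (length≡trues+falses e) (trans (cong₂ _+_ t f) (m+[n∸m]≡n k≤n))

moves-∈-shuffles : ∀ {n k π} → IsPerm n π → length (dp π) ≡ k → moves 1 π ∈ shuffles k (n ∸ k)
moves-∈-shuffles {n} {k} {π} π-perm |dpπ|≡k = ∈-shuffles⁺ (moves 1 π) t f
  where
  open ≡-Reasoning
  t : trues (moves 1 π) ≡ k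
  t = trans (trues-moves 1 π) (trans (sym (length-map _ (nonFixedFrom 1 π))) |dpπ|≡k)
  f : falses (moves 1 π) ≡ n ∸ k
  f = begin
    falses (moves 1 π)                           ≡⟨ m+n∸m≡n k _ ⟨
    k + falses (moves 1 π) ∸ k                   ≡⟨ cong (λ t → t + falses (moves 1 π) ∸ k) t ⟨
    trues (moves 1 π) + falses (moves 1 π) ∸ k   ≡⟨ cong (_∸ k) (length≡trues+falses (moves 1 π)) ⟨
    length (moves 1 π) ∸ k                       ≡⟨ cong (_∸ k) (trans (length-moves 1 π) (proj₁ π-perm)) ⟩
    n ∸ k                                        ∎

fiber-↭ : ∀ {n k σ} → k ≤ n → IsDerangement k σ → fiber n σ ↭ map (inflate σ) (shuffles k (n ∸ k))
fiber-↭ {n} {k} {σ} k≤n σ-der@(σ-perm , σ-noFix) =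
  same-members⇒↭ (Unique.filter⁺ _ (Sn-unique n)) image-unique fiber⊆image image⊆fiber
  where
  S = shuffles k (n ∸ k)
  image-unique : Unique (map (inflate σ) S)
  image-unique = Unique.map⁻ (subst Unique (sym moves∘inflate) (shuffles-unique k (n ∸ k)))
    where
    moves∘inflate : map (moves 1) (map (inflate σ) S) ≡ S
    moves∘inflate = trans (sym (map-∘ S)) (map-id-local (All.tabulate λ {e} e∈ →
      Inflation.moves-inflate {e = e} σ-perm (proj₁ (∈-shuffles⁻ k (n ∸ k) e∈)) σ-noFix))
  image⊆fiber : ∀ {π} → π ∈ map (inflate σ) S → π ∈ fiber n σ
  image⊆fiber π∈ with ∈-map⁻ (inflate σ) π∈
  ... | _ , e∈ , refl = inflate-∈-fiber k≤n σ-der e∈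
  fiber⊆image : ∀ {π} → π ∈ fiber n σ → π ∈ map (inflate σ) S
  fiber⊆image {π} π∈ with ∈-filter⁻ _ {xs = Sn n} π∈
  ... | π∈Sn , dpπ≡σ = subst (_∈ map (inflate σ) S) inflate-moves≡π
                             (∈-map⁺ (inflate σ) (moves-∈-shuffles π-perm (trans (cong length dpπ≡σ) (proj₁ σ-perm))))
    where
    π-perm = ∈-Sn⁻ π∈Sn
    inflate-moves≡π : inflate σ (moves 1 π) ≡ π
    inflate-moves≡π = trans (cong (λ τ → inflate τ (moves 1 π)) (sym dpπ≡σ)) (inflate-dp-moves π-perm)

-- Summing q^maj over the fixed-point sets

length-fill : ∀ β r u → trues r ≡ length u → length (fill β r u) ≡ length u + falses r
length-fill β [] [] _ = refl
length-fill β (true ∷ r) (x ∷ u) t = cong suc (length-fill β r u (suc-injective t))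
length-fill β (false ∷ r) u t = trans (cong suc (length-fill β r u t)) (sym (+-suc (length u) (falses r)))

lead : (ℕ → Bool) → List ℕ → ℕ
lead lt [] = 0
lead lt (x ∷ w) = if lt x then suc (length w) else 0

revMaj-∷ : ∀ a w → revMaj (a ∷ w) ≡ lead (a <ᵇ_) w + revMaj w
revMaj-∷ a [] = refl
revMaj-∷ a (b ∷ w) = refl

Upward : (ℕ → Bool) → Set
Upward lt = ∀ {x y} → x < y → lt x ≡ true → lt y ≡ true

<ᵇ-upward : ∀ c → Upward (c <ᵇ_)
<ᵇ-upward c {x} x<y c<ᵇx = <ᵇ-true (<-trans (<ᵇ⇒< c x (subst T (sym c<ᵇx) _)) x<y)

-- Each letter lies on the same side of the blank values just before and just after it.
SameSide : (ℕ → ℕ) → List ℕ → Set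
SameSide β [] = ⊤
SameSide β (x ∷ u) = x ≢ β (suc (length u)) × (x <ᵇ β (length u)) ≡ (x <ᵇ β (suc (length u))) × SameSide β u

sel : Bool → ℤ → ℤ
sel c x = if c then x else ℤ.1ℤ

sel-1 : ∀ c → sel c ℤ.1ℤ ≡ ℤ.1ℤ
sel-1 true = refl
sel-1 false = refl

module _ (q : ℤ) where

  ^-if : ∀ c n → q ^ (if c then n else 0) ≡ sel c (q ^ n)
  ^-if true n = refl
  ^-if false n = refl

  qint-+ : ∀ a b → qint q (a + b) ≡ qint q a +ᶻ q ^ a * qint q b
  qint-+ zero b = sym (trans (ℤ.+-identityˡ _) (ℤ.*-identityˡ _))
  qint-+ (suc a) b = trans (cong (λ t → ℤ.1ℤ +ᶻ q * t) (qint-+ a b)) (expand q (qint q a) (q ^ a) (qint q b))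
    where
    expand : ∀ q x p y → ℤ.1ℤ +ᶻ q * (x +ᶻ p * y) ≡ ℤ.1ℤ +ᶻ q * x +ᶻ (q * p) * y
    expand = ℤ-Solver.solve-∀

  qint-+-swap : ∀ a b → qint q a +ᶻ q ^ a * qint q b ≡ qint q b +ᶻ q ^ b * qint q a
  qint-+-swap a b = trans (sym (qint-+ a b)) (trans (cong (qint q) (+-comm a b)) (qint-+ b a))

-- The six consistent orderings of a first letter, the next letter and the next blank; both
-- q-Pascal rules [k+m] = [k] + q^k [m] = [m] + q^m [k] are needed.
pascal-step : ∀ (α β γ : Bool) → (γ ≡ true → α ≡ true → β ≡ true) → (γ ≡ false → β ≡ true → α ≡ true) →
  ∀ (a b K M : ℤ) → K +ᶻ a * M ≡ M +ᶻ b * K →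
  sel α (a * b) * sel γ b * K +ᶻ sel β (a * b) * sel (not γ) a * M ≡ sel α a * sel β b * (K +ᶻ a * M)
pascal-step true true true _ _ a b K M swap = trans (id₁ a b K M) (cong (a * b *_) (sym swap))
  where
  id₁ : ∀ a b K M → a * b * b * K +ᶻ a * b * ℤ.1ℤ * M ≡ a * b * (M +ᶻ b * K)
  id₁ = ℤ-Solver.solve-∀
pascal-step false false true _ _ a b K M swap = trans (id₂ a b K M) (cong (ℤ.1ℤ * ℤ.1ℤ *_) (sym swap))
  where
  id₂ : ∀ a b K M → ℤ.1ℤ * b * K +ᶻ ℤ.1ℤ * ℤ.1ℤ * M ≡ ℤ.1ℤ * ℤ.1ℤ * (M +ᶻ b * K)
  id₂ = ℤ-Solver.solve-∀
pascal-step false true true _ _ a b K M _ = id₃ a b K M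
  where
  id₃ : ∀ a b K M → ℤ.1ℤ * b * K +ᶻ a * b * ℤ.1ℤ * M ≡ ℤ.1ℤ * b * (K +ᶻ a * M)
  id₃ = ℤ-Solver.solve-∀
pascal-step true false true γ→α→β _ _ _ _ _ _ with () ← γ→α→β refl refl
pascal-step true true false _ _ a b K M _ = id₄ a b K M
  where
  id₄ : ∀ a b K M → a * b * ℤ.1ℤ * K +ᶻ a * b * a * M ≡ a * b * (K +ᶻ a * M)
  id₄ = ℤ-Solver.solve-∀
pascal-step false false false _ _ a b K M _ = id₅ a b K M
  where
  id₅ : ∀ a b K M → ℤ.1ℤ * ℤ.1ℤ * K +ᶻ ℤ.1ℤ * a * M ≡ ℤ.1ℤ * ℤ.1ℤ * (K +ᶻ a * M)
  id₅ = ℤ-Solver.solve-∀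
pascal-step true false false _ _ a b K M swap = trans (id₆ a b K M) (cong (a * ℤ.1ℤ *_) (sym swap))
  where
  id₆ : ∀ a b K M → a * b * ℤ.1ℤ * K +ᶻ ℤ.1ℤ * a * M ≡ a * ℤ.1ℤ * (M +ᶻ b * K)
  id₆ = ℤ-Solver.solve-∀
pascal-step false true false _ ¬γ→β→α _ _ _ _ _ with () ← ¬γ→β→α refl refl

module FillSum (q : ℤ) (β : ℕ → ℕ) where

  weight : (ℕ → Bool) → List ℕ → ℤ
  weight lt w = q ^ (lead lt w + revMaj w)

  -- With lt = (c <ᵇ_) this sums over the words c ∷ fill β r u; lt = λ _ → false drops c.
  fillSum : (ℕ → Bool) → List ℕ → ℕ → ℤ
  fillSum lt u m = Σ (λ r → weight lt (fill β r u)) (shuffles (length u) m)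

  closedForm : (ℕ → Bool) → List ℕ → ℕ → ℤ
  closedForm lt u m = weight lt u * sel (lt (β (length u))) (q ^ m) * qfact q (length u + m)

  weight-∷ : ∀ lt c w → weight lt (c ∷ w) ≡ sel (lt c) (q ^ suc (length w)) * weight (c <ᵇ_) w
  weight-∷ lt c w = begin
    q ^ ((if lt c then suc (length w) else 0) + revMaj (c ∷ w))
      ≡⟨ cong (λ x → q ^ ((if lt c then suc (length w) else 0) + x)) (revMaj-∷ c w) ⟩
    q ^ ((if lt c then suc (length w) else 0) + (lead (c <ᵇ_) w + revMaj w))
      ≡⟨ ℤ.^-distribˡ-+-* q (if lt c then suc (length w) else 0) _ ⟩
    q ^ (if lt c then suc (length w) else 0) * weight (c <ᵇ_) w
      ≡⟨ cong (_* weight (c <ᵇ_) w) (^-if q (lt c) (suc (length w))) ⟩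
    sel (lt c) (q ^ suc (length w)) * weight (c <ᵇ_) w ∎
    where open ≡-Reasoning

  Σ-weight-∷ : ∀ lt c v m n → length v + m ≡ n →
            Σ (λ r → weight lt (c ∷ fill β r v)) (shuffles (length v) m) ≡ sel (lt c) (q ^ suc n) * fillSum (c <ᵇ_) v m
  Σ-weight-∷ lt c v m n |v|+m≡n =
    trans (Σ-cong (shuffles (length v) m) split)
          (Σ-*ˡ (sel (lt c) (q ^ suc n)) (λ r → weight (c <ᵇ_) (fill β r v)) (shuffles (length v) m))
    where
    split : ∀ {r} → r ∈ shuffles (length v) m →
            weight lt (c ∷ fill β r v) ≡ sel (lt c) (q ^ suc n) * weight (c <ᵇ_) (fill β r v)
    split {r} r∈ with ∈-shuffles⁻ (length v) m r∈
    ... | t , f = trans (weight-∷ lt c (fill β r v))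
                        (cong (λ l → sel (lt c) (q ^ suc l) * weight (c <ᵇ_) (fill β r v))
                              (trans (length-fill β r v t) (trans (cong (length v +_) f) |v|+m≡n)))

  fillSum-[]-suc : ∀ lt m → fillSum lt [] (suc m) ≡ sel (lt (β 0)) (q ^ suc m) * fillSum (β 0 <ᵇ_) [] m
  fillSum-[]-suc lt m =
    trans (Σ-map (λ r → weight lt (fill β r [])) (false ∷_) (shuffles 0 m)) (Σ-weight-∷ lt (β 0) [] m m refl)

  fillSum-∷-zero : ∀ lt x u → fillSum lt (x ∷ u) 0 ≡ sel (lt x) (q ^ suc (length u)) * fillSum (x <ᵇ_) u 0
  fillSum-∷-zero lt x u =
    trans (Σ-map (λ r → weight lt (fill β r (x ∷ u))) (true ∷_) (shuffles (length u) 0))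
          (Σ-weight-∷ lt x u 0 (length u) (+-identityʳ (length u)))

  fillSum-∷-suc : ∀ lt x u m → let k = suc (length u) in
    fillSum lt (x ∷ u) (suc m) ≡
      sel (lt x) (q ^ (k + suc m)) * fillSum (x <ᵇ_) u (suc m) +ᶻ
      sel (lt (β k)) (q ^ (k + suc m)) * fillSum (β k <ᵇ_) (x ∷ u) m
  fillSum-∷-suc lt x u m = begin
    Σ f (map (true ∷_) (shuffles (length u) (suc m)) ++ map (false ∷_) (shuffles (suc (length u)) m))
      ≡⟨ Σ-++ f (map (true ∷_) (shuffles (length u) (suc m))) _ ⟩
    Σ f (map (true ∷_) (shuffles (length u) (suc m))) +ᶻ Σ f (map (false ∷_) (shuffles (suc (length u)) m))
      ≡⟨ cong₂ _+ᶻ_ (Σ-map f (true ∷_) (shuffles (length u) (suc m))) (Σ-map f (false ∷_) (shuffles (suc (length u)) m)) ⟩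
    Σ (λ r → weight lt (x ∷ fill β r u)) (shuffles (length u) (suc m)) +ᶻ
    Σ (λ r → weight lt (β (suc (length u)) ∷ fill β r (x ∷ u))) (shuffles (suc (length u)) m)
      ≡⟨ cong₂ _+ᶻ_ (Σ-weight-∷ lt x u (suc m) (length u + suc m) refl)
                    (Σ-weight-∷ lt (β (suc (length u))) (x ∷ u) m (length u + suc m) (sym (+-suc (length u) m))) ⟩
    sel (lt x) (q ^ (suc (length u) + suc m)) * fillSum (x <ᵇ_) u (suc m) +ᶻ
    sel (lt (β (suc (length u)))) (q ^ (suc (length u) + suc m)) * fillSum (β (suc (length u)) <ᵇ_) (x ∷ u) m ∎
    where
    open ≡-Reasoning
    f : List Bool → ℤ
    f r = weight lt (fill β r (x ∷ u))

  fillSum-closedForm : ∀ lt → Upward lt → ∀ u m → SameSide β u →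
                   fillSum lt u m * (qfact q (length u) * qfact q m) ≡ closedForm lt u m
  fillSum-closedForm lt _ [] zero _ with lt (β 0)
  ... | true = refl
  ... | false = refl
  fillSum-closedForm lt _ [] (suc m) _ = begin
    fillSum lt [] (suc m) * (ℤ.1ℤ * (qfact q m * [m+1]))
      ≡⟨ cong (_* (ℤ.1ℤ * (qfact q m * [m+1]))) (fillSum-[]-suc lt m) ⟩
    s * Y * (ℤ.1ℤ * (qfact q m * [m+1]))
      ≡⟨ regroup s Y (qfact q m) [m+1] ⟩
    s * [m+1] * (Y * (ℤ.1ℤ * qfact q m))
      ≡⟨ cong (s * [m+1] *_) (fillSum-closedForm (β 0 <ᵇ_) (<ᵇ-upward (β 0)) [] m _) ⟩
    s * [m+1] * (ℤ.1ℤ * sel (β 0 <ᵇ β 0) (q ^ m) * qfact q m)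
      ≡⟨ cong (λ d → s * [m+1] * (ℤ.1ℤ * sel d (q ^ m) * qfact q m)) (<ᵇ-false (n≮n (β 0))) ⟩
    s * [m+1] * (ℤ.1ℤ * ℤ.1ℤ * qfact q m)
      ≡⟨ regroup′ s [m+1] (qfact q m) ⟩
    ℤ.1ℤ * s * (qfact q m * [m+1]) ∎
    where
    open ≡-Reasoning
    s = sel (lt (β 0)) (q ^ suc m)
    Y = fillSum (β 0 <ᵇ_) [] m
    [m+1] = qint q (suc m)
    regroup : ∀ s Y F I → s * Y * (ℤ.1ℤ * (F * I)) ≡ s * I * (Y * (ℤ.1ℤ * F))
    regroup = ℤ-Solver.solve-∀
    regroup′ : ∀ s I F → s * I * (ℤ.1ℤ * ℤ.1ℤ * F) ≡ ℤ.1ℤ * s * (F * I)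
    regroup′ = ℤ-Solver.solve-∀
  fillSum-closedForm lt _ (x ∷ u) zero (_ , _ , u-sides) = begin
    fillSum lt (x ∷ u) 0 * (qfact q k′ * [k] * ℤ.1ℤ)
      ≡⟨ cong (_* (qfact q k′ * [k] * ℤ.1ℤ)) (fillSum-∷-zero lt x u) ⟩
    s * X * (qfact q k′ * [k] * ℤ.1ℤ)
      ≡⟨ regroup s X (qfact q k′) [k] ⟩
    s * [k] * (X * (qfact q k′ * ℤ.1ℤ))
      ≡⟨ cong (s * [k] *_) (fillSum-closedForm (x <ᵇ_) (<ᵇ-upward x) u 0 u-sides) ⟩
    s * [k] * (w * sel (x <ᵇ β k′) ℤ.1ℤ * qfact q (k′ + 0))
      ≡⟨ cong₂ (λ t n → s * [k] * (w * t * qfact q n)) (sel-1 (x <ᵇ β k′)) (+-identityʳ k′) ⟩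
    s * [k] * (w * ℤ.1ℤ * qfact q k′)
      ≡⟨ regroup′ s [k] w (qfact q k′) ⟩
    s * w * ℤ.1ℤ * (qfact q k′ * [k])
      ≡⟨ cong (λ v → v * ℤ.1ℤ * qfact q k) (weight-∷ lt x u) ⟨
    weight lt (x ∷ u) * ℤ.1ℤ * qfact q k
      ≡⟨ cong₂ (λ t F → weight lt (x ∷ u) * t * F) (sel-1 (lt (β k))) (cong (qfact q) (+-identityʳ k)) ⟨
    weight lt (x ∷ u) * sel (lt (β k)) ℤ.1ℤ * qfact q (k + 0) ∎
    where
    open ≡-Reasoning
    k′ = length u
    k = suc k′
    [k] = qint q k
    s = sel (lt x) (q ^ k)
    X = fillSum (x <ᵇ_) u 0
    w = weight (x <ᵇ_) u
    regroup : ∀ s X F I → s * X * (F * I * ℤ.1ℤ) ≡ s * I * (X * (F * ℤ.1ℤ))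
    regroup = ℤ-Solver.solve-∀
    regroup′ : ∀ s I w F → s * I * (w * ℤ.1ℤ * F) ≡ s * w * ℤ.1ℤ * (F * I)
    regroup′ = ℤ-Solver.solve-∀
  fillSum-closedForm lt lt↑ (x ∷ u) (suc m) (x≢βk , same-side , u-sides) = begin
    fillSum lt (x ∷ u) (suc m) * (qfact q k′ * [k] * (qfact q m * [M]))
      ≡⟨ cong (_* (qfact q k′ * [k] * (qfact q m * [M]))) (fillSum-∷-suc lt x u m) ⟩
    (sel α ab * X +ᶻ sel β′ ab * Y) * (qfact q k′ * [k] * (qfact q m * [M]))
      ≡⟨ distribute (sel α ab) X (sel β′ ab) Y (qfact q k′) [k] (qfact q m) [M] ⟩
    sel α ab * [k] * (X * (qfact q k′ * (qfact q m * [M]))) +ᶻ sel β′ ab * [M] * (Y * (qfact q k′ * [k] * qfact q m))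
      ≡⟨ cong₂ (λ s t → sel α ab * [k] * s +ᶻ sel β′ ab * [M] * t)
               (trans (fillSum-closedForm (x <ᵇ_) (<ᵇ-upward x) u (suc m) u-sides) first-closed)
               (trans (fillSum-closedForm (β k <ᵇ_) (<ᵇ-upward (β k)) (x ∷ u) m (x≢βk , same-side , u-sides)) second-closed) ⟩
    sel α ab * [k] * (w * sel γ b * G) +ᶻ sel β′ ab * [M] * (sel (not γ) a * w * ℤ.1ℤ * G)
      ≡⟨ factor (sel α ab) [k] w (sel γ b) G (sel β′ ab) [M] (sel (not γ) a) ⟩
    w * G * (sel α ab * sel γ b * [k] +ᶻ sel β′ ab * sel (not γ) a * [M])
      ≡⟨ cong (λ t → w * G * (sel α t * sel γ b * [k] +ᶻ sel β′ t * sel (not γ) a * [M])) (ℤ.^-distribˡ-+-* q k M) ⟩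
    w * G * (sel α (a * b) * sel γ b * [k] +ᶻ sel β′ (a * b) * sel (not γ) a * [M])
      ≡⟨ cong (w * G *_) (pascal-step α β′ γ up down a b [k] [M] (qint-+-swap q k M)) ⟩
    w * G * (sel α a * sel β′ b * ([k] +ᶻ a * [M]))
      ≡⟨ cong (λ t → w * G * (sel α a * sel β′ b * t)) (qint-+ q k M) ⟨
    w * G * (sel α a * sel β′ b * qint q (k + M))
      ≡⟨ collect w G (sel α a) (sel β′ b) (qint q (k + M)) ⟩
    sel α a * w * sel β′ b * (G * qint q (k + M))
      ≡⟨ cong (λ v → v * sel β′ b * (G * qint q (k + M))) (weight-∷ lt x u) ⟨
    weight lt (x ∷ u) * sel β′ b * qfact q (k + M) ∎
    where
    open ≡-Reasoning
    k′ = length u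
    k = suc k′
    M = suc m
    [k] = qint q k
    [M] = qint q M
    a = q ^ k
    b = q ^ M
    ab = q ^ (k + M)
    α = lt x
    β′ = lt (β k)
    γ = x <ᵇ β k
    X = fillSum (x <ᵇ_) u M
    Y = fillSum (β k <ᵇ_) (x ∷ u) m
    w = weight (x <ᵇ_) u
    G = qfact q (k′ + M)
    up : γ ≡ true → α ≡ true → β′ ≡ true
    up γ≡true = lt↑ (<ᵇ⇒< x (β k) (subst T (sym γ≡true) _))
    down : γ ≡ false → β′ ≡ true → α ≡ true
    down γ≡false = lt↑ (≤∧≢⇒< (≮⇒≥ (λ x<βk → subst T γ≡false (<⇒<ᵇ x<βk))) (x≢βk ∘ sym))
    first-closed : closedForm (x <ᵇ_) u M ≡ w * sel γ b * G
    first-closed = cong (λ c → w * sel c b * G) same-side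
    second-closed : closedForm (β k <ᵇ_) (x ∷ u) m ≡ sel (not γ) a * w * ℤ.1ℤ * G
    second-closed = begin
      weight (β k <ᵇ_) (x ∷ u) * sel (β k <ᵇ β k) (q ^ m) * qfact q (k + m)
        ≡⟨ cong₂ (λ v F → v * sel (β k <ᵇ β k) (q ^ m) * F)
                 (weight-∷ (β k <ᵇ_) x u) (cong (qfact q) (sym (+-suc k′ m))) ⟩
      sel (β k <ᵇ x) a * w * sel (β k <ᵇ β k) (q ^ m) * G
        ≡⟨ cong₂ (λ c d → sel c a * w * sel d (q ^ m) * G) (<ᵇ-flip x≢βk) (<ᵇ-false (n≮n (β k))) ⟩
      sel (not γ) a * w * ℤ.1ℤ * G ∎
    distribute : ∀ s X t Y F I E J →
      (s * X +ᶻ t * Y) * (F * I * (E * J)) ≡ s * I * (X * (F * (E * J))) +ᶻ t * J * (Y * (F * I * E))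
    distribute = ℤ-Solver.solve-∀
    factor : ∀ s I w g G t J h → s * I * (w * g * G) +ᶻ t * J * (h * w * ℤ.1ℤ * G) ≡ w * G * (s * g * I +ᶻ t * h * J)
    factor = ℤ-Solver.solve-∀
    collect : ∀ w G s t N → w * G * (s * t * N) ≡ s * w * t * (G * N)
    collect = ℤ-Solver.solve-∀

  Σ-revMaj-fill : ∀ u m → SameSide β u →
    Σ (λ r → q ^ revMaj (fill β r u)) (shuffles (length u) m) * (qfact q (length u) * qfact q m)
      ≡ q ^ revMaj u * qfact q (length u + m)
  Σ-revMaj-fill u m u-sides = begin
    Σ (λ r → q ^ revMaj (fill β r u)) (shuffles (length u) m) * (qfact q (length u) * qfact q m)
      ≡⟨ cong (_* (qfact q (length u) * qfact q m)) (Σ-cong (shuffles (length u) m) no-lead) ⟩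
    fillSum never u m * (qfact q (length u) * qfact q m)
      ≡⟨ fillSum-closedForm never (λ _ ()) u m u-sides ⟩
    q ^ (lead never u + revMaj u) * ℤ.1ℤ * qfact q (length u + m)
      ≡⟨ cong (_* qfact q (length u + m)) (ℤ.*-identityʳ (q ^ (lead never u + revMaj u))) ⟩
    q ^ (lead never u + revMaj u) * qfact q (length u + m)
      ≡⟨ cong (λ l → q ^ (l + revMaj u) * qfact q (length u + m)) (lead-false u) ⟩
    q ^ revMaj u * qfact q (length u + m) ∎
    where
    open ≡-Reasoning
    never : ℕ → Bool
    never _ = false
    lead-false : ∀ w → lead never w ≡ 0
    lead-false [] = refl
    lead-false (x ∷ w) = refl
    no-lead : ∀ {r} → r ∈ shuffles (length u) m → q ^ revMaj (fill β r u) ≡ weight never (fill β r u)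
    no-lead {r} _ = cong (λ l → q ^ (l + revMaj (fill β r u))) (sym (lead-false (fill β r u)))

NoFixʳ : List ℕ → Set
NoFixʳ [] = ⊤
NoFixʳ (x ∷ u) = x ≢ suc (length u) × NoFixʳ u

noFix-ʳ++ : ∀ {i} w acc → NoFixFrom i w → NoFixʳ acc → suc (length acc) ≡ i → NoFixʳ (w ʳ++ acc)
noFix-ʳ++ [] acc _ acc-noFix _ = acc-noFix
noFix-ʳ++ (x ∷ w) acc (x≢i , w-noFix) acc-noFix refl = noFix-ʳ++ w (x ∷ acc) w-noFix (x≢i , acc-noFix) refl

double≢key : ∀ x t → double x ≢ key t
double≢key zero t ()
double≢key (suc x) zero eq = 1+n≢0 (trans (sym (+-suc x x)) (suc-injective eq))
double≢key (suc x) (suc t) eq =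
  double≢key x t (suc-injective (trans (sym (+-suc x x)) (trans (suc-injective eq) (cong suc (+-suc t t)))))

double-<ᵇ-key : ∀ x t → (double x <ᵇ key t) ≡ (x <ᵇ suc t)
double-<ᵇ-key zero t = refl
double-<ᵇ-key (suc x) zero = refl
double-<ᵇ-key (suc x) (suc t) rewrite +-suc x x | +-suc t t = double-<ᵇ-key x t

-- Here the derangement hypothesis enters: 2x lies strictly between key t and key (suc t)
-- exactly when x = suc t.
sameSide-key : ∀ ρ → NoFixʳ ρ → SameSide key (map double ρ)
sameSide-key [] _ = _
sameSide-key (x ∷ ρ) (x≢ , ρ-noFix) rewrite length-map double ρ =
  double≢key x (suc (length ρ)) ,
  trans (double-<ᵇ-key x (length ρ)) (trans (below-both (length ρ) x≢) (sym (double-<ᵇ-key x (suc (length ρ))))) ,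
  sameSide-key ρ ρ-noFix
  where
  below-both : ∀ t → x ≢ suc t → (x <ᵇ suc t) ≡ (x <ᵇ suc (suc t))
  below-both t x≢1+t with x <? suc t
  ... | yes x<1+t = trans (<ᵇ-true x<1+t) (sym (<ᵇ-true (m<n⇒m<1+n x<1+t)))
  ... | no x≮1+t = trans (<ᵇ-false x≮1+t) (sym (<ᵇ-false (≤⇒≯ (≤∧≢⇒< (≮⇒≥ x≮1+t) (x≢1+t ∘ sym)))))

Σ-fill-derangement : ∀ {k σ} (q : ℤ) → IsDerangement k σ → ∀ m →
  Σ (λ r → q ^ revMaj (fill key r (map double (reverse σ)))) (shuffles k m) * (qfact q k * qfact q m)
    ≡ q ^ maj σ * qfact q (k + m)
Σ-fill-derangement {k} {σ} q (σ-perm , σ-noFix) m =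
  subst (λ l → Σ (λ r → q ^ revMaj (fill key r ρ)) (shuffles l m) * (qfact q l * qfact q m) ≡ q ^ maj σ * qfact q (l + m))
        |ρ|≡k
        (trans (FillSum.Σ-revMaj-fill q key ρ m (sameSide-key (reverse σ) (noFix-ʳ++ σ [] σ-noFix _ refl)))
               (cong (λ d → q ^ d * qfact q (length ρ + m)) (sym (maj-double-reverse σ))))
  where
  ρ = map double (reverse σ)
  |ρ|≡k : length ρ ≡ k
  |ρ|≡k = trans (length-map double (reverse σ)) (trans (length-reverse σ) (proj₁ σ-perm))

fiber-sum : ∀ {n k σ} (q : ℤ) → k ≤ n → IsDerangement k σ →
  lhs q n σ ≡ sgn (inv σ) * Σ (λ r → q ^ revMaj (fill key r (map double (reverse σ)))) (shuffles k (n ∸ k))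
fiber-sum {n} {k} {σ} q k≤n σ-der@(σ-perm , _) = begin
  Σ (wt q) (fiber n σ)                                         ≡⟨ Σ-↭ (wt q) (fiber-↭ k≤n σ-der) ⟩
  Σ (wt q) (map (inflate σ) S)                                 ≡⟨ Σ-map (wt q) (inflate σ) S ⟩
  Σ (wt q ∘ inflate σ) S                                       ≡⟨ Σ-cong S inflated-weight ⟩
  Σ (λ e → sgn (inv σ) * f (reverse e)) S                      ≡⟨ Σ-*ˡ (sgn (inv σ)) (f ∘ reverse) S ⟩
  sgn (inv σ) * Σ (f ∘ reverse) S                              ≡⟨ cong (sgn (inv σ) *_) (Σ-map f reverse S) ⟨
  sgn (inv σ) * Σ f (map reverse S)                            ≡⟨ cong (sgn (inv σ) *_) (Σ-↭ f (shuffles-reverse k (n ∸ k))) ⟩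
  sgn (inv σ) * Σ f S                                          ∎
  where
  open ≡-Reasoning
  S = shuffles k (n ∸ k)
  f : List Bool → ℤ
  f r = q ^ revMaj (fill key r (map double (reverse σ)))
  inflated-weight : ∀ {e} → e ∈ S → wt q (inflate σ e) ≡ sgn (inv σ) * f (reverse e)
  inflated-weight {e} e∈ = cong₂ (λ s d → s * q ^ d) sgn-inflate maj-inflate
    where open Inflation {e = e} σ-perm (proj₁ (∈-shuffles⁻ k (n ∸ k) e∈))

proposition2p6 : (n k : ℕ) → k ≤ n → (σ : List ℕ) → IsDerangement k σ →
    (q : ℤ) →
      lhs q n σ * (qfact q k * qfact q (n ∸ k))
        ≡ wt q σ * qfact q n
proposition2p6 n k k≤n σ σ-der q = begin
  lhs q n σ * (qfact q k * qfact q m)             ≡⟨ cong (_* (qfact q k * qfact q m)) (fiber-sum q k≤n σ-der) ⟩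
  sgn (inv σ) * S * (qfact q k * qfact q m)       ≡⟨ ℤ.*-assoc (sgn (inv σ)) S _ ⟩
  sgn (inv σ) * (S * (qfact q k * qfact q m))     ≡⟨ cong (sgn (inv σ) *_) (Σ-fill-derangement q σ-der m) ⟩
  sgn (inv σ) * (q ^ maj σ * qfact q (k + m))     ≡⟨ cong (λ l → sgn (inv σ) * (q ^ maj σ * qfact q l)) (m+[n∸m]≡n k≤n) ⟩
  sgn (inv σ) * (q ^ maj σ * qfact q n)           ≡⟨ ℤ.*-assoc (sgn (inv σ)) _ _ ⟨
  wt q σ * qfact q n                              ∎
  where
  open ≡-Reasoning
  m = n ∸ k
  S = Σ (λ r → q ^ revMaj (fill key r (map double (reverse σ)))) (shuffles k m)
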